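{- Let $N\ge 1$ be an integer. For every integer $n\ge 1$, $$ BC_{N,n}=\Pi(n)\sum_{k=1}^{n}\binom{n+1}{k+1}(-D_N)^k\sum_{\substack{i_1,\dots,i_k\ge 0\\ r^{N+i_1}+\cdots+r^{N+i_k}=n+k r^N}}\frac{1}{D_{N+i_1}\cdots D_{N+i_k}}\,. $$
   Context: Let $r$ be a power of a prime, $T$ an indeterminate and $K=\mathbb F_r(T)$. For $i\ge 1$ put $[i]=T^{r^i}-T$ and $D_i=[i][i-1]^r[i-2]^{r^2}\cdots[1]^{r^{i-1}}$, with $D_0=1$. The Carlitz exponential is the formal power series $e_C(x)=\sum_{i=0}^\infty x^{r^i}/D_i\in K[[x]]$. For a non-negative integer $i$ with base-$r$ expansion $i=\sum_{j=0}^m c_j r^j$ ($0\le c_j<r$), the Carlitz factorial is $\Pi(i)=\prod_{j=0}^m D_j^{c_j}$. For $N\ge 1$, the truncated Bernoulli-Carlitz numbers $BC_{N,n}\in K$ are defined by the formal power series identity $$ \frac{x^{r^N}/D_N}{e_C(x)-\sum_{i=0}^{N-1}x^{r^i}/D_i}=\sum_{n=0}^\infty\frac{BC_{N,n}}{\Pi(n)}x^n . $$ The binomial coefficient $\binom{n+1}{k+1}$ is the ordinary integer, viewed in $K$. -}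

module Defs where

open import Level using (Level; _⊔_) renaming (suc to lsuc)
open import Algebra.Bundles using (CommutativeRing)
open import Data.Nat using (ℕ; zero; suc; _∸_; NonZero; _/_; _%_; _≟_) renaming (_*_ to _*ℕ_; _+_ to _+ℕ_; _^_ to _^ℕ_)
open import Data.Nat.Combinatorics using (_C_)
open import Data.Fin using (Fin)
open import Data.List using (List; []; _∷_; map; replicate; _++_; foldr; concatMap; upTo)
open import Data.Vec using (Vec) renaming ([] to []ᵥ; _∷_ to _∷ᵥ_)
open import Data.Bool using (if_then_else_)
open import Data.Product using (∃; _×_)
open import Relation.Nullary using (¬_)
open import Relation.Nullary.Decidable using (⌊_⌋)
open import Relation.Binary.PropositionalEquality using (_≡_)

record FiniteField (r : ℕ) (c ℓ : Level) : Set (lsuc (c ⊔ ℓ)) where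
  field
    commRing : CommutativeRing c ℓ
  open CommutativeRing commRing public
  field
    1≉0 : ¬ (1# ≈ 0#)
    inverse : ∀ x → ¬ (x ≈ 0#) → ∃ λ y → (x * y) ≈ 1#
    enum : Fin r → Carrier
    enum-surjective : ∀ x → ∃ λ i → enum i ≈ x
    enum-injective : ∀ i j → enum i ≈ enum j → i ≡ j

module CarlitzBC {r : ℕ} {{_ : NonZero r}} {c ℓ : Level} (F : FiniteField r c ℓ) where
  open FiniteField F renaming (Carrier to 𝔽)

  -- Polynomials 𝔽[T] as little-endian coefficient lists
  Poly : Set c
  Poly = List 𝔽

  coeff : Poly → ℕ → 𝔽
  coeff [] _ = 0#
  coeff (a ∷ p) zero = a
  coeff (a ∷ p) (suc i) = coeff p i

  _≈ₚ_ : Poly → Poly → Set ℓ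
  p ≈ₚ q = ∀ i → coeff p i ≈ coeff q i

  _+ₚ_ : Poly → Poly → Poly
  [] +ₚ q = q
  (a ∷ p) +ₚ [] = a ∷ p
  (a ∷ p) +ₚ (b ∷ q) = (a + b) ∷ (p +ₚ q)

  -ₚ_ : Poly → Poly
  -ₚ p = map -_ p

  _·ₚ_ : 𝔽 → Poly → Poly
  a ·ₚ p = map (a *_) p

  _*ₚ_ : Poly → Poly → Poly
  [] *ₚ q = []
  (a ∷ p) *ₚ q = (a ·ₚ q) +ₚ (0# ∷ (p *ₚ q))

  0ₚ 1ₚ : Poly
  0ₚ = []
  1ₚ = 1# ∷ []

  _^ₚ_ : Poly → ℕ → Poly
  p ^ₚ zero = 1ₚ
  p ^ₚ suc n = p *ₚ (p ^ₚ n)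

  T^ : ℕ → Poly
  T^ m = replicate m 0# ++ (1# ∷ [])

  bracket : ℕ → Poly
  bracket i = T^ (r ^ℕ i) +ₚ (-ₚ T^ 1)

  -- D_0 = 1, D_i = [i] [i-1]^r ... [1]^{r^{i-1}} = [i] · D_{i-1}^r
  D : ℕ → Poly
  D zero = 1ₚ
  D (suc i) = bracket (suc i) *ₚ (D i ^ₚ r)

  -- Carlitz factorial Π(n) = ∏_j D_j^{c_j}, c_j the base-r digits of n
  -- (first argument is fuel; n base-r digits never exceed n of them)
  Π-aux : ℕ → ℕ → ℕ → Poly
  Π-aux zero n j = 1ₚ
  Π-aux (suc f) n j = (D j ^ₚ (n % r)) *ₚ Π-aux f (n / r) (suc j)

  Π : ℕ → Poly
  Π n = Π-aux n n 0

  -- K = 𝔽(T) as fractions num/den (genuine elements have den ≉ 0)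
  record K : Set c where
    constructor _/ₖ_
    field
      num : Poly
      den : Poly
  open K public

  _≈ₖ_ : K → K → Set ℓ
  x ≈ₖ y = (num x *ₚ den y) ≈ₚ (num y *ₚ den x)

  _+ₖ_ : K → K → K
  (a /ₖ b) +ₖ (c' /ₖ d) = ((a *ₚ d) +ₚ (c' *ₚ b)) /ₖ (b *ₚ d)

  _*ₖ_ : K → K → K
  (a /ₖ b) *ₖ (c' /ₖ d) = (a *ₚ c') /ₖ (b *ₚ d)

  -ₖ_ : K → K
  -ₖ (a /ₖ b) = (-ₚ a) /ₖ b

  _-ₖ_ : K → K → K
  x -ₖ y = x +ₖ (-ₖ y)

  -- division (only applied to divisors with nonzero numerator)
  _÷ₖ_ : K → K → K
  (a /ₖ b) ÷ₖ (c' /ₖ d) = (a *ₚ d) /ₖ (b *ₚ c')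

  0ₖ 1ₖ : K
  0ₖ = 0ₚ /ₖ 1ₚ
  1ₖ = 1ₚ /ₖ 1ₚ

  inj : Poly → K
  inj p = p /ₖ 1ₚ

  _^ₖ_ : K → ℕ → K
  x ^ₖ zero = 1ₖ
  x ^ₖ suc n = x *ₖ (x ^ₖ n)

  ℕ→𝔽 : ℕ → 𝔽
  ℕ→𝔽 zero = 0#
  ℕ→𝔽 (suc n) = 1# + ℕ→𝔽 n

  ℕ→K : ℕ → K
  ℕ→K n = inj (ℕ→𝔽 n ∷ [])

  Σ≤ : ℕ → (ℕ → K) → K
  Σ≤ zero f = f 0
  Σ≤ (suc n) f = Σ≤ n f +ₖ f (suc n)

  Σ< : ℕ → (ℕ → K) → K
  Σ< zero f = 0ₖ
  Σ< (suc n) f = Σ< n f +ₖ f n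

  Σ1≤ : ℕ → (ℕ → K) → K
  Σ1≤ zero f = 0ₖ
  Σ1≤ (suc n) f = Σ1≤ n f +ₖ f (suc n)

  sumList : List K → K
  sumList = foldr _+ₖ_ 0ₖ

  when≡ : ℕ → ℕ → K → K
  when≡ a b x = if ⌊ a ≟ b ⌋ then x else 0ₖ

  -- coefficient of x^l in e_C(x) = Σ_{i≥0} x^{r^i}/D_i
  -- (only i ≤ l can have r^i = l)
  eC-coeff : ℕ → K
  eC-coeff l = Σ≤ l (λ i → when≡ (r ^ℕ i) l (1ₖ ÷ₖ inj (D i)))

  partial-coeff : ℕ → ℕ → K
  partial-coeff N l = Σ< N (λ i → when≡ (r ^ℕ i) l (1ₖ ÷ₖ inj (D i)))

  denom-coeff : ℕ → ℕ → K
  denom-coeff N l = eC-coeff l -ₖ partial-coeff N l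

  numer-coeff : ℕ → ℕ → K
  numer-coeff N m = when≡ m (r ^ℕ N) (1ₖ ÷ₖ inj (D N))

  -- BC : ℕ → K is the sequence BC_{N,n} defined by
  --   (x^{r^N}/D_N) / (e_C(x) - Σ_{i<N} x^{r^i}/D_i) = Σ_n BC_{N,n}/Π(n) x^n,
  -- i.e. (Σ_n BC_{N,n}/Π(n) x^n) · (e_C(x) - Σ_{i<N} x^{r^i}/D_i) = x^{r^N}/D_N
  -- coefficientwise (this determines BC uniquely).
  IsBC : ℕ → (ℕ → K) → Set ℓ
  IsBC N BC =
    (∀ n → ¬ (den (BC n) ≈ₚ 0ₚ)) ×
    (∀ m → Σ≤ m (λ j → (BC j ÷ₖ inj (Π j)) *ₖ denom-coeff N (m ∸ j)) ≈ₖ numer-coeff N m)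

  allVecs : (k B : ℕ) → List (Vec ℕ k)
  allVecs zero B = []ᵥ ∷ []
  allVecs (suc k) B = concatMap (λ i → map (i ∷ᵥ_) (allVecs k B)) (upTo (suc B))

  sumPowers : ℕ → {k : ℕ} → Vec ℕ k → ℕ
  sumPowers N []ᵥ = 0
  sumPowers N (i ∷ᵥ v) = r ^ℕ (N +ℕ i) +ℕ sumPowers N v

  prodD : ℕ → {k : ℕ} → Vec ℕ k → Poly
  prodD N []ᵥ = 1ₚ
  prodD N (i ∷ᵥ v) = D (N +ℕ i) *ₚ prodD N v

  -- Every i_j in such a tuple satisfies i_j < r^{N+i_j} ≤ n + k r^N, so the
  -- enumeration bound B = n + k r^N covers all terms.
  innerSum : ℕ → ℕ → ℕ → K
  innerSum N k n =
    sumList (map (λ v → when≡ (sumPowers N v) (n +ℕ k *ℕ r ^ℕ N) (1ₖ ÷ₖ inj (prodD N v)))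
                 (allVecs k (n +ℕ k *ℕ r ^ℕ N)))

  formula : ℕ → ℕ → K
  formula N n =
    inj (Π n) *ₖ Σ1≤ n (λ k → (ℕ→K (suc n C suc k) *ₖ ((-ₖ inj (D N)) ^ₖ k)) *ₖ innerSum N k n)

module Submission where

-- Let s = r^N, E = e_C(x) - ∑_{i<N} x^{r^i}/D_i = ∑_{j≥0} x^{r^{N+j}}/D_{N+j} and
-- g = -D_N x^{-s} E, a power series with constant term -1. By definition
-- A = ∑_n BC_{N,n}/Π(n) x^n satisfies A·g = -1, so A = 1/(1 - (1 + g)) = ∑_m (1 + g)^m.
-- Since (1 + g)^m = O(x^m), only m ≤ n contribute to the coefficient of x^n, and expanding
-- binomially with ∑_{m≤n} C(m,k) = C(n+1,k+1) gives A_n = ∑_k C(n+1,k+1) [x^n] g^k.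
-- Finally [x^n] g^k = (-D_N)^k [x^{n+ks}] E^k, and [x^{n+ks}] E^k is the inner sum of the formula.

open import Level using (Level; _⊔_)
open import Function using (_$_; id)
open import Data.Bool using (true; false; if_then_else_)
open import Data.Empty using (⊥-elim; ⊥-elim-irr)
open import Data.Fin using () renaming (_≟_ to _≟ᶠ_)
open import Data.List using (List; []; _∷_; _++_; map; foldr; concatMap; applyUpTo; upTo)
open import Data.List.Properties using (map-∘)
open import Data.Nat using (ℕ; zero; suc; NonZero; _≤_; _<_; z≤n; s≤s; z<s; _∸_; _%_; _/_)
  renaming (_+_ to _+ℕ_; _*_ to _*ℕ_; _^_ to _^ℕ_)
import Data.Nat.Properties as ℕ
open import Data.Nat.Properties
  using (≤-refl; ≤-trans; ≤-reflexive; ≤-pred; <⇒≤; <-trans; <-≤-trans; ≤-<-trans; <-irrefl; ≤∧≢⇒<; ≰⇒>; ≮⇒≥;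
         n<1+n; m≤n⇒m≤1+n; m≤m+n; m≤n+m; m<m+n; +-suc; +-monoˡ-≤; +-monoʳ-≤; +-cancelˡ-<;
         n∸n≡0; m∸n≤m; m∸n+n≡m; m+n∸n≡m; m+n∸m≡n; m+[n∸m]≡n; m∸[m∸n]≡n; +-∸-assoc; ∸-monoʳ-<;
         ^-monoʳ-≤; ^-monoʳ-<)
open import Data.Nat.Combinatorics using (_C_; k>n⇒nCk≡0; nCk+nC[k+1]≡[n+1]C[k+1])
open import Data.Nat.Induction using (<-rec)
open import Data.Nat.Tactic.RingSolver using (solve-∀)
open import Data.Product using (_,_; proj₁; proj₂)
open import Data.Vec using (Vec) renaming ([] to []ᵥ; _∷_ to _∷ᵥ_)
open import Relation.Nullary using (¬_; Dec; yes; no)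
open import Relation.Nullary.Decidable using (⌊_⌋)
open import Relation.Binary.PropositionalEquality as ≡ using (_≡_; _≢_)
open import Algebra.Bundles using (CommutativeSemiring; CommutativeRing; Semiring)

open import Defs

m∸n<o : ∀ {m n o} → n ≤ m → m < n +ℕ o → m ∸ n < o
m∸n<o {m} {n} {o} n≤m m<n+o = +-cancelˡ-< n (m ∸ n) o (≡.subst (_< n +ℕ o) (≡.sym (m+[n∸m]≡n n≤m)) m<n+o)

module FiniteSums {a ℓ : Level} (R : CommutativeSemiring a ℓ) where
  open CommutativeSemiring R
  open import Algebra.Properties.CommutativeSemigroup +-commutativeSemigroup using () renaming (interchange to +-interchange)
  open import Relation.Binary.Reasoning.Setoid setoid

  sum : ℕ → (ℕ → Carrier) → Carrier
  sum zero f = 0#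
  sum (suc n) f = sum n f + f n

  sum-cong< : ∀ n {f g : ℕ → Carrier} → (∀ i → i < n → f i ≈ g i) → sum n f ≈ sum n g
  sum-cong< zero e = refl
  sum-cong< (suc n) e = +-cong (sum-cong< n λ i i<n → e i (m≤n⇒m≤1+n i<n)) (e n ≤-refl)

  sum-cong : ∀ n {f g : ℕ → Carrier} → (∀ i → f i ≈ g i) → sum n f ≈ sum n g
  sum-cong n e = sum-cong< n λ i _ → e i

  sum-zero : ∀ n {f : ℕ → Carrier} → (∀ i → i < n → f i ≈ 0#) → sum n f ≈ 0#
  sum-zero zero e = refl
  sum-zero (suc n) e = trans (+-cong (sum-zero n λ i i<n → e i (m≤n⇒m≤1+n i<n)) (e n ≤-refl)) (+-identityˡ 0#)

  sum-+ : ∀ n (f g : ℕ → Carrier) → sum n (λ i → f i + g i) ≈ sum n f + sum n g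
  sum-+ zero f g = sym (+-identityˡ 0#)
  sum-+ (suc n) f g = trans (+-congʳ (sum-+ n f g)) (+-interchange _ _ _ _)

  *-distribˡ-sum : ∀ n x (f : ℕ → Carrier) → x * sum n f ≈ sum n (λ i → x * f i)
  *-distribˡ-sum zero x f = zeroʳ x
  *-distribˡ-sum (suc n) x f = trans (distribˡ x _ _) (+-congʳ (*-distribˡ-sum n x f))

  *-distribʳ-sum : ∀ n x (f : ℕ → Carrier) → sum n f * x ≈ sum n (λ i → f i * x)
  *-distribʳ-sum n x f = trans (*-comm _ x) (trans (*-distribˡ-sum n x f) (sum-cong n λ i → *-comm x (f i)))

  sum-suc : ∀ n (f : ℕ → Carrier) → sum (suc n) f ≈ f 0 + sum n (λ i → f (suc i))
  sum-suc zero f = trans (+-identityˡ (f 0)) (sym (+-identityʳ (f 0)))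
  sum-suc (suc n) f = trans (+-congʳ (sum-suc n f)) (+-assoc _ _ _)

  sum-split : ∀ m n (f : ℕ → Carrier) → sum (m +ℕ n) f ≈ sum m f + sum n (λ i → f (m +ℕ i))
  sum-split m zero f rewrite ℕ.+-identityʳ m = sym (+-identityʳ _)
  sum-split m (suc n) f rewrite +-suc m n = trans (+-congʳ (sum-split m n f)) (+-assoc _ _ _)

  sum-extend : ∀ m n (f : ℕ → Carrier) → m ≤ n → (∀ i → m ≤ i → i < n → f i ≈ 0#) → sum n f ≈ sum m f
  sum-extend _ zero f z≤n _ = refl
  sum-extend m (suc n) f m≤1+n z with m ℕ.≟ suc n
  ... | yes ≡.refl = refl
  ... | no m≢1+n = trans (+-cong (sum-extend m n f m≤n λ i m≤i i<n → z i m≤i (m≤n⇒m≤1+n i<n)) (z n m≤n ≤-refl))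
                         (+-identityʳ _)
    where
    m≤n : m ≤ n
    m≤n = ≤-pred (≤∧≢⇒< m≤1+n m≢1+n)

  sum-swap : ∀ m n (f : ℕ → ℕ → Carrier) → sum m (λ i → sum n (f i)) ≈ sum n (λ j → sum m (λ i → f i j))
  sum-swap zero n f = sym (sum-zero n λ _ _ → refl)
  sum-swap (suc m) n f = trans (+-congʳ (sum-swap m n f)) (sym (sum-+ n _ _))

  sum-reverse : ∀ n (f : ℕ → Carrier) → sum (suc n) f ≈ sum (suc n) (λ i → f (n ∸ i))
  sum-reverse zero f = refl
  sum-reverse (suc n) f = begin
    sum (suc n) f + f (suc n)                     ≈⟨ +-comm _ _ ⟩
    f (suc n) + sum (suc n) f                     ≈⟨ +-congˡ (sum-reverse n f) ⟩
    f (suc n) + sum (suc n) (λ i → f (n ∸ i))     ≈⟨ sum-suc (suc n) (λ i → f (suc n ∸ i)) ⟨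
    sum (suc (suc n)) (λ i → f (suc n ∸ i))       ∎

  sum-δ : ∀ n (f : ℕ → Carrier) k → k < n → (∀ i → i < n → i ≢ k → f i ≈ 0#) → sum n f ≈ f k
  sum-δ (suc n) f k k<1+n z with k ℕ.≟ n
  ... | yes ≡.refl = trans (+-congʳ (sum-zero n λ i i<n → z i (m≤n⇒m≤1+n i<n) λ i≡k → <-irrefl i≡k i<n)) (+-identityˡ _)
  ... | no k≢n = trans (+-cong (sum-δ n f k (≤∧≢⇒< (≤-pred k<1+n) k≢n) λ i i<n → z i (m≤n⇒m≤1+n i<n))
                               (z n ≤-refl λ n≡k → k≢n (≡.sym n≡k)))
                       (+-identityʳ _)

  listSum : List Carrier → Carrier
  listSum = foldr _+_ 0#

  module _ {b : Level} {A : Set b} where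

    listSum-map-cong : ∀ xs {φ ψ : A → Carrier} → (∀ x → φ x ≈ ψ x) → listSum (map φ xs) ≈ listSum (map ψ xs)
    listSum-map-cong [] e = refl
    listSum-map-cong (x ∷ xs) e = +-cong (e x) (listSum-map-cong xs e)

    listSum-map-zero : ∀ xs {φ : A → Carrier} → (∀ x → φ x ≈ 0#) → listSum (map φ xs) ≈ 0#
    listSum-map-zero [] z = refl
    listSum-map-zero (x ∷ xs) z = trans (+-cong (z x) (listSum-map-zero xs z)) (+-identityʳ 0#)

    *-distribˡ-listSum : ∀ xs y (φ : A → Carrier) → y * listSum (map φ xs) ≈ listSum (map (λ x → y * φ x) xs)
    *-distribˡ-listSum [] y φ = zeroʳ y
    *-distribˡ-listSum (x ∷ xs) y φ = trans (distribˡ y _ _) (+-congˡ (*-distribˡ-listSum xs y φ))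

    listSum-map-++ : ∀ xs ys (φ : A → Carrier) → listSum (map φ (xs ++ ys)) ≈ listSum (map φ xs) + listSum (map φ ys)
    listSum-map-++ [] ys φ = sym (+-identityˡ _)
    listSum-map-++ (x ∷ xs) ys φ = trans (+-congˡ (listSum-map-++ xs ys φ)) (sym (+-assoc _ _ _))

    listSum-map-applyUpTo : ∀ (f : ℕ → A) n (φ : A → Carrier) → listSum (map φ (applyUpTo f n)) ≈ sum n (λ i → φ (f i))
    listSum-map-applyUpTo f zero φ = refl
    listSum-map-applyUpTo f (suc n) φ =
      trans (+-congˡ (listSum-map-applyUpTo (λ i → f (suc i)) n φ)) (sym (sum-suc n (λ i → φ (f i))))

    listSum-map-concatMap : ∀ {B : Set b} (h : B → List A) xs (φ : A → Carrier) →
                            listSum (map φ (concatMap h xs)) ≈ listSum (map (λ x → listSum (map φ (h x))) xs)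
    listSum-map-concatMap h [] φ = refl
    listSum-map-concatMap h (x ∷ xs) φ = trans (listSum-map-++ (h x) (concatMap h xs) φ) (+-congˡ (listSum-map-concatMap h xs φ))

module Convolution {a ℓ : Level} (R : CommutativeRing a ℓ) where
  open CommutativeRing R
  open FiniteSums commutativeSemiring
  open import Algebra.Properties.Ring ring using (-1*x≈-x; -‿involutive)
  open import Algebra.Properties.Group +-group using (inverseʳ-unique) renaming (∙-cancelˡ to +-cancelˡ)
  open import Algebra.Properties.Semiring.Mult semiring using (_×_; ×-homo-1; ×-homo-+)
  open import Algebra.Properties.CommutativeSemigroup *-commutativeSemigroup using (x∙yz≈y∙xz)
  open import Relation.Binary.Reasoning.Setoid setoid

  δ : ℕ → Carrier
  δ zero = 1#
  δ (suc n) = 0#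

  infixl 7 _⊛_
  _⊛_ : (ℕ → Carrier) → (ℕ → Carrier) → ℕ → Carrier
  (f ⊛ h) n = sum (suc n) (λ j → f j * h (n ∸ j))

  ⊛-comm : ∀ f h n → (f ⊛ h) n ≈ (h ⊛ f) n
  ⊛-comm f h n = begin
    sum (suc n) (λ j → f j * h (n ∸ j))
      ≈⟨ sum-reverse n _ ⟩
    sum (suc n) (λ j → f (n ∸ j) * h (n ∸ (n ∸ j)))
      ≈⟨ sum-cong< (suc n) (λ j j<1+n → trans (*-comm _ _) (*-congʳ (reflexive (≡.cong h (m∸[m∸n]≡n (≤-pred j<1+n)))))) ⟩
    sum (suc n) (λ j → h j * f (n ∸ j)) ∎

  ⊛-distrib-sum : ∀ m (w : ℕ → Carrier) h (G : ℕ → ℕ → Carrier) n →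
                  sum m (λ k → w k * (h ⊛ G k) n) ≈ (h ⊛ (λ t → sum m (λ k → w k * G k t))) n
  ⊛-distrib-sum m w h G n = begin
    sum m (λ k → w k * sum (suc n) (λ j → h j * G k (n ∸ j)))    ≈⟨ sum-cong m (λ k → *-distribˡ-sum (suc n) (w k) _) ⟩
    sum m (λ k → sum (suc n) (λ j → w k * (h j * G k (n ∸ j))))  ≈⟨ sum-swap m (suc n) _ ⟩
    sum (suc n) (λ j → sum m (λ k → w k * (h j * G k (n ∸ j))))
      ≈⟨ sum-cong (suc n) (λ j → sum-cong m (λ k → x∙yz≈y∙xz (w k) (h j) _)) ⟩
    sum (suc n) (λ j → sum m (λ k → h j * (w k * G k (n ∸ j))))  ≈⟨ sum-cong (suc n) (λ j → *-distribˡ-sum m (h j) _) ⟨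
    sum (suc n) (λ j → h j * sum m (λ k → w k * G k (n ∸ j)))    ∎

  -- Coefficients of A ⊛ h are triangular in those of A, with diagonal h 0.
  ⊛-cancelʳ : ∀ {h A B} u → h 0 * u ≈ 1# → ∀ n → (∀ j → j ≤ n → (A ⊛ h) j ≈ (B ⊛ h) j) →
              ∀ j → j ≤ n → A j ≈ B j
  ⊛-cancelʳ {h} {A} {B} u h₀u≈1 n A⊛h≈B⊛h = <-rec _ step
    where
    step : ∀ j → (∀ {i} → i < j → i ≤ n → A i ≈ B i) → j ≤ n → A j ≈ B j
    step j ih j≤n = begin
      A j              ≈⟨ *-identityʳ (A j) ⟨
      A j * 1#         ≈⟨ *-congˡ h₀u≈1 ⟨
      A j * (h 0 * u)  ≈⟨ *-assoc (A j) (h 0) u ⟨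
      A j * h 0 * u    ≈⟨ *-congʳ diagonal ⟩
      B j * h 0 * u    ≈⟨ *-assoc (B j) (h 0) u ⟩
      B j * (h 0 * u)  ≈⟨ *-congˡ h₀u≈1 ⟩
      B j * 1#         ≈⟨ *-identityʳ (B j) ⟩
      B j              ∎
      where
      below : sum j (λ i → A i * h (j ∸ i)) ≈ sum j (λ i → B i * h (j ∸ i))
      below = sum-cong< j λ i i<j → *-congʳ (ih i<j (≤-trans (<⇒≤ i<j) j≤n))
      diagonal : A j * h 0 ≈ B j * h 0
      diagonal = ≡.subst (λ d → A j * h d ≈ B j * h d) (n∸n≡0 j)
                   (+-cancelˡ _ _ _ (trans (+-congʳ (sym below)) (A⊛h≈B⊛h j j≤n)))

  ⊛-shift : ∀ {f h} s m → (∀ i → i < s → f i ≈ 0#) → (∀ i → i < m → h i ≈ 0#) → ∀ n →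
            (f ⊛ h) (n +ℕ (s +ℕ m)) ≈ sum (suc n) (λ j → f (s +ℕ j) * h ((n ∸ j) +ℕ m))
  ⊛-shift {f} {h} s m f-below h-below n = begin
    sum (suc T) ψ                              ≡⟨ ≡.cong (λ k → sum k ψ) (reorder₁ n s m) ⟩
    sum (s +ℕ (suc n +ℕ m)) ψ                  ≈⟨ sum-split s (suc n +ℕ m) ψ ⟩
    sum s ψ + sum (suc n +ℕ m) (λ i → ψ (s +ℕ i))
      ≈⟨ +-congʳ (sum-zero s λ i i<s → trans (*-congʳ (f-below i i<s)) (zeroˡ _)) ⟩
    0# + sum (suc n +ℕ m) (λ i → ψ (s +ℕ i))   ≈⟨ +-identityˡ _ ⟩
    sum (suc n +ℕ m) (λ i → ψ (s +ℕ i))        ≈⟨ sum-extend (suc n) (suc n +ℕ m) _ (m≤m+n (suc n) m) beyond ⟩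
    sum (suc n) (λ i → ψ (s +ℕ i))
      ≈⟨ sum-cong< (suc n) (λ j j<1+n → *-congˡ (reflexive (≡.cong h (shift j (≤-pred j<1+n))))) ⟩
    sum (suc n) (λ j → f (s +ℕ j) * h ((n ∸ j) +ℕ m)) ∎
    where
    T = n +ℕ (s +ℕ m)
    reorder₁ : ∀ n s m → suc (n +ℕ (s +ℕ m)) ≡ s +ℕ (suc n +ℕ m)
    reorder₁ = solve-∀
    reorder₂ : ∀ a j s m → (a +ℕ j) +ℕ (s +ℕ m) ≡ (a +ℕ m) +ℕ (s +ℕ j)
    reorder₂ = solve-∀
    reorder₃ : ∀ s n m → s +ℕ (n +ℕ m) ≡ n +ℕ (s +ℕ m)
    reorder₃ = solve-∀
    reorder₄ : ∀ n s m → suc (n +ℕ (s +ℕ m)) ≡ (s +ℕ suc n) +ℕ m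
    reorder₄ = solve-∀
    ψ : ℕ → Carrier
    ψ i = f i * h (T ∸ i)
    shift : ∀ j → j ≤ n → T ∸ (s +ℕ j) ≡ (n ∸ j) +ℕ m
    shift j j≤n = ≡.trans (≡.cong (λ k → k +ℕ (s +ℕ m) ∸ (s +ℕ j)) (≡.sym (m∸n+n≡m j≤n)))
                          (≡.trans (≡.cong (_∸ (s +ℕ j)) (reorder₂ (n ∸ j) j s m)) (m+n∸n≡m ((n ∸ j) +ℕ m) (s +ℕ j)))
    beyond : ∀ i → suc n ≤ i → i < suc n +ℕ m → ψ (s +ℕ i) ≈ 0#
    beyond i n<i i<1+n+m = trans (*-congˡ (h-below _ (m∸n<o s+i≤T T<s+i+m))) (zeroʳ _)
      where
      s+i≤T : s +ℕ i ≤ T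
      s+i≤T = ≤-trans (+-monoʳ-≤ s (≤-pred i<1+n+m)) (≤-reflexive (reorder₃ s n m))
      T<s+i+m : T < (s +ℕ i) +ℕ m
      T<s+i+m = ≤-trans (≤-reflexive (reorder₄ n s m)) (+-monoˡ-≤ m (+-monoʳ-≤ s n<i))

  -- If F k is the k-th convolution power of g and g 0 = -1, then -g has the
  -- convolution inverse ∑ₘ (δ + g)^⊛m, whose n-th coefficient is the
  -- binomial sum below.
  module ConvolutionPowers (g : ℕ → Carrier) (g₀≈-1 : g 0 ≈ - 1#)
                           (F : ℕ → ℕ → Carrier) (F-zero : ∀ n → F 0 n ≈ δ n)
                           (F-suc : ∀ k n → F (suc k) n ≈ (g ⊛ F k) n) where

    binomial : ℕ → ℕ → Carrier
    binomial m k = (m C k) × 1#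

    binomial-pascal : ∀ m k → binomial (suc m) (suc k) ≈ binomial m k + binomial m (suc k)
    binomial-pascal m k = trans (reflexive (≡.cong (_× 1#) (≡.sym (nCk+nC[k+1]≡[n+1]C[k+1] m k)))) (×-homo-+ 1# (m C k) (m C suc k))

    binomialPower : ℕ → ℕ → Carrier
    binomialPower m n = sum (suc m) (λ k → binomial m k * F k n)

    binomialPower-suc : ∀ m n → binomialPower (suc m) n ≈ binomialPower m n + (g ⊛ binomialPower m) n
    binomialPower-suc m n = begin
      binomialPower (suc m) n
        ≈⟨ sum-suc (suc m) _ ⟩
      binomial (suc m) 0 * F 0 n + sum (suc m) (λ k → binomial (suc m) (suc k) * F (suc k) n)
        ≈⟨ +-congˡ (sum-cong (suc m) λ k → trans (*-congʳ (binomial-pascal m k)) (distribʳ _ _ _)) ⟩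
      binomial m 0 * F 0 n + sum (suc m) (λ k → binomial m k * F (suc k) n + binomial m (suc k) * F (suc k) n)
        ≈⟨ +-congˡ (trans (sum-+ (suc m) _ _) (+-comm _ _)) ⟩
      binomial m 0 * F 0 n + (sum (suc m) (λ k → binomial m (suc k) * F (suc k) n) + sum (suc m) (λ k → binomial m k * F (suc k) n))
        ≈⟨ +-assoc _ _ _ ⟨
      (binomial m 0 * F 0 n + sum (suc m) (λ k → binomial m (suc k) * F (suc k) n)) + sum (suc m) (λ k → binomial m k * F (suc k) n)
        ≈⟨ +-cong (sym (sum-suc (suc m) _)) (sum-cong (suc m) λ k → *-congˡ (F-suc k n)) ⟩
      (binomialPower m n + binomial m (suc m) * F (suc m) n) + sum (suc m) (λ k → binomial m k * (g ⊛ F k) n)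
        ≈⟨ +-cong (+-congˡ (trans (*-congʳ binomial-top) (zeroˡ _))) (⊛-distrib-sum (suc m) (binomial m) g F n) ⟩
      (binomialPower m n + 0#) + (g ⊛ binomialPower m) n
        ≈⟨ +-congʳ (+-identityʳ _) ⟩
      binomialPower m n + (g ⊛ binomialPower m) n ∎
      where
      binomial-top : binomial m (suc m) ≈ 0#
      binomial-top = reflexive (≡.cong (_× 1#) (k>n⇒nCk≡0 (n<1+n m)))

    binomialPower-vanishes : ∀ m n → n < m → binomialPower m n ≈ 0#
    binomialPower-vanishes (suc m) n n<1+m = begin
      binomialPower (suc m) n
        ≈⟨ binomialPower-suc m n ⟩
      binomialPower m n + (g ⊛ binomialPower m) n
        ≈⟨ +-congˡ (sum-suc n _) ⟩
      binomialPower m n + (g 0 * binomialPower m n + sum n (λ j → g (suc j) * binomialPower m (n ∸ suc j)))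
        ≈⟨ +-assoc _ _ _ ⟨
      (binomialPower m n + g 0 * binomialPower m n) + sum n (λ j → g (suc j) * binomialPower m (n ∸ suc j))
        ≈⟨ +-cong cancel (sum-zero n λ j j<n → trans (*-congˡ (binomialPower-vanishes m _ (lower j<n))) (zeroʳ _)) ⟩
      0# + 0#
        ≈⟨ +-identityʳ 0# ⟩
      0# ∎
      where
      cancel : binomialPower m n + g 0 * binomialPower m n ≈ 0#
      cancel = trans (+-congˡ (trans (*-congʳ g₀≈-1) (-1*x≈-x _))) (-‿inverseʳ _)
      lower : ∀ {j} → j < n → n ∸ suc j < m
      lower {j} j<n = <-≤-trans (∸-monoʳ-< {n} {suc j} {0} z<s j<n) (≤-pred n<1+m)

    -- ∑_{m ≤ n} (δ + g)^⊛m, rewritten by the hockey-stick identity ∑_{m ≤ n} C(m,k) = C(n+1,k+1).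
    geometricSum : ℕ → ℕ → Carrier
    geometricSum n t = sum (suc n) (λ k → binomial (suc n) (suc k) * F k t)

    g⊛geometricSum : ∀ n j → j ≤ n → (g ⊛ geometricSum n) j ≈ - δ j
    g⊛geometricSum n j j≤n = begin
      (g ⊛ geometricSum n) j                                      ≈⟨ ⊛-distrib-sum (suc n) _ g F j ⟨
      sum (suc n) (λ k → binomial (suc n) (suc k) * (g ⊛ F k) j)  ≈⟨ sum-cong (suc n) (λ k → *-congˡ (F-suc k j)) ⟨
      sum (suc n) (λ k → binomial (suc n) (suc k) * F (suc k) j)  ≈⟨ inverseʳ-unique _ _ completed ⟩
      - (binomial (suc n) 0 * F 0 j)
        ≈⟨ -‿cong (trans (*-congʳ (×-homo-1 1#)) (trans (*-identityˡ _) (F-zero j))) ⟩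
      - δ j                                                       ∎
      where
      completed : binomial (suc n) 0 * F 0 j + sum (suc n) (λ k → binomial (suc n) (suc k) * F (suc k) j) ≈ 0#
      completed = trans (sym (sum-suc (suc n) _)) (binomialPower-vanishes (suc n) j (s≤s j≤n))

    ⊛g≈-δ⇒geometricSum : ∀ A → (∀ n → (A ⊛ g) n ≈ - δ n) → ∀ n → A n ≈ geometricSum n n
    ⊛g≈-δ⇒geometricSum A A⊛g≈-δ n = ⊛-cancelʳ {g} (- 1#) g₀*-1≈1 n agree n ≤-refl
      where
      g₀*-1≈1 : g 0 * - 1# ≈ 1#
      g₀*-1≈1 = trans (*-congʳ g₀≈-1) (trans (-1*x≈-x (- 1#)) (-‿involutive 1#))
      agree : ∀ j → j ≤ n → (A ⊛ g) j ≈ (geometricSum n ⊛ g) j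
      agree j j≤n = trans (A⊛g≈-δ j) (sym (trans (⊛-comm _ g j) (g⊛geometricSum n j j≤n)))

module FieldProperties {r : ℕ} {c ℓ : Level} (F : FiniteField r c ℓ) where
  open FiniteField F renaming (Carrier to 𝔽)
  open import Relation.Binary.Reasoning.Setoid setoid

  infix 4 _≟_
  _≟_ : ∀ x y → Dec (x ≈ y)
  x ≟ y with enum-surjective x | enum-surjective y
  ... | i , eᵢ≈x | j , eⱼ≈y with i ≟ᶠ j
  ... | yes ≡.refl = yes (trans (sym eᵢ≈x) eⱼ≈y)
  ... | no i≢j = no λ x≈y → i≢j (enum-injective i j (trans eᵢ≈x (trans x≈y (sym eⱼ≈y))))

  *-nonZero : ∀ {a b} → ¬ a ≈ 0# → ¬ b ≈ 0# → ¬ a * b ≈ 0#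
  *-nonZero {a} {b} a≉0 b≉0 ab≈0 with inverse a a≉0
  ... | a⁻¹ , aa⁻¹≈1 = b≉0 (begin
    b              ≈⟨ *-identityˡ b ⟨
    1# * b         ≈⟨ *-congʳ aa⁻¹≈1 ⟨
    (a * a⁻¹) * b  ≈⟨ *-congʳ (*-comm a a⁻¹) ⟩
    (a⁻¹ * a) * b  ≈⟨ *-assoc a⁻¹ a b ⟩
    a⁻¹ * (a * b)  ≈⟨ *-congˡ ab≈0 ⟩
    a⁻¹ * 0#       ≈⟨ zeroʳ a⁻¹ ⟩
    0#             ∎)

module Polynomials {r : ℕ} {{_ : NonZero r}} {c ℓ : Level} (F : FiniteField r c ℓ) where
  open FiniteField F hiding (zero) renaming (Carrier to 𝔽)
  open FieldProperties F
  open CarlitzBC F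
  open import Algebra.Properties.Ring ring using (-0#≈0#)
  open import Algebra.Properties.CommutativeSemigroup +-commutativeSemigroup using () renaming (interchange to +-interchange)
  open import Relation.Binary.Reasoning.Setoid setoid

  -- _≈ₚ_ wrapped in a record, so that both polynomials can be inferred from a proof.
  infix 4 _≋_
  record _≋_ (p q : Poly) : Set ℓ where
    constructor mk
    field coeff-≈ : p ≈ₚ q
  open _≋_ public

  ≋-refl : ∀ {p} → p ≋ p
  ≋-refl = mk λ _ → refl

  ≋-sym : ∀ {p q} → p ≋ q → q ≋ p
  ≋-sym (mk e) = mk λ i → sym (e i)

  ≋-trans : ∀ {p q s} → p ≋ q → q ≋ s → p ≋ s
  ≋-trans (mk e) (mk f) = mk λ i → trans (e i) (f i)

  ∷-cong : ∀ {a b p q} → a ≈ b → p ≋ q → a ∷ p ≋ b ∷ q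
  ∷-cong a≈b (mk e) = mk λ { zero → a≈b ; (suc i) → e i }

  ∷-≋0 : ∀ {a p} → a ≈ 0# → p ≋ 0ₚ → a ∷ p ≋ 0ₚ
  ∷-≋0 a≈0 (mk e) = mk λ { zero → a≈0 ; (suc i) → e i }

  ∷-injectiveˡ : ∀ {a b p q} → a ∷ p ≋ b ∷ q → a ≈ b
  ∷-injectiveˡ (mk e) = e zero

  ∷-injectiveʳ : ∀ {a b p q} → a ∷ p ≋ b ∷ q → p ≋ q
  ∷-injectiveʳ (mk e) = mk λ i → e (suc i)

  ∷-≋0⇒head≈0 : ∀ {a p} → a ∷ p ≋ 0ₚ → a ≈ 0#
  ∷-≋0⇒head≈0 (mk e) = e zero

  ∷-≋0⇒tail≋0 : ∀ {a p} → a ∷ p ≋ 0ₚ → p ≋ 0ₚ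
  ∷-≋0⇒tail≋0 (mk e) = mk λ i → e (suc i)

  coeff-+ : ∀ p q i → coeff (p +ₚ q) i ≈ coeff p i + coeff q i
  coeff-+ [] q i = sym (+-identityˡ _)
  coeff-+ (a ∷ p) [] i = sym (+-identityʳ _)
  coeff-+ (a ∷ p) (b ∷ q) zero = refl
  coeff-+ (a ∷ p) (b ∷ q) (suc i) = coeff-+ p q i

  coeff-neg : ∀ p i → coeff (-ₚ p) i ≈ - coeff p i
  coeff-neg [] i = sym -0#≈0#
  coeff-neg (a ∷ p) zero = refl
  coeff-neg (a ∷ p) (suc i) = coeff-neg p i

  coeff-· : ∀ a p i → coeff (a ·ₚ p) i ≈ a * coeff p i
  coeff-· a [] i = sym (zeroʳ a)
  coeff-· a (b ∷ p) zero = refl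
  coeff-· a (b ∷ p) (suc i) = coeff-· a p i

  +ₚ-cong : ∀ {p p′ q q′} → p ≋ p′ → q ≋ q′ → p +ₚ q ≋ p′ +ₚ q′
  +ₚ-cong {p} {p′} {q} {q′} (mk e) (mk f) = mk λ i → begin
    coeff (p +ₚ q) i        ≈⟨ coeff-+ p q i ⟩
    coeff p i + coeff q i   ≈⟨ +-cong (e i) (f i) ⟩
    coeff p′ i + coeff q′ i ≈⟨ coeff-+ p′ q′ i ⟨
    coeff (p′ +ₚ q′) i      ∎

  +ₚ-comm : ∀ p q → p +ₚ q ≋ q +ₚ p
  +ₚ-comm p q = mk λ i → trans (coeff-+ p q i) (trans (+-comm _ _) (sym (coeff-+ q p i)))

  +ₚ-assoc : ∀ p q s → (p +ₚ q) +ₚ s ≋ p +ₚ (q +ₚ s)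
  +ₚ-assoc p q s = mk λ i → begin
    coeff ((p +ₚ q) +ₚ s) i               ≈⟨ coeff-+ (p +ₚ q) s i ⟩
    coeff (p +ₚ q) i + coeff s i          ≈⟨ +-congʳ (coeff-+ p q i) ⟩
    (coeff p i + coeff q i) + coeff s i   ≈⟨ +-assoc _ _ _ ⟩
    coeff p i + (coeff q i + coeff s i)   ≈⟨ +-congˡ (coeff-+ q s i) ⟨
    coeff p i + coeff (q +ₚ s) i          ≈⟨ coeff-+ p (q +ₚ s) i ⟨
    coeff (p +ₚ (q +ₚ s)) i               ∎

  +ₚ-identityʳ : ∀ p → p +ₚ 0ₚ ≋ p
  +ₚ-identityʳ p = mk λ i → trans (coeff-+ p [] i) (+-identityʳ _)

  -ₚ-inverseˡ : ∀ p → (-ₚ p) +ₚ p ≋ 0ₚ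
  -ₚ-inverseˡ p = mk λ i → trans (coeff-+ (-ₚ p) p i) (trans (+-congʳ (coeff-neg p i)) (-‿inverseˡ _))

  -ₚ-inverseʳ : ∀ p → p +ₚ (-ₚ p) ≋ 0ₚ
  -ₚ-inverseʳ p = ≋-trans (+ₚ-comm p (-ₚ p)) (-ₚ-inverseˡ p)

  -ₚ-cong : ∀ {p q} → p ≋ q → -ₚ p ≋ -ₚ q
  -ₚ-cong {p} {q} (mk e) = mk λ i → trans (coeff-neg p i) (trans (-‿cong (e i)) (sym (coeff-neg q i)))

  +ₚ-interchange : ∀ p q s t → (p +ₚ q) +ₚ (s +ₚ t) ≋ (p +ₚ s) +ₚ (q +ₚ t)
  +ₚ-interchange p q s t = mk λ i → begin
    coeff ((p +ₚ q) +ₚ (s +ₚ t)) i                      ≈⟨ coeff-+ (p +ₚ q) (s +ₚ t) i ⟩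
    coeff (p +ₚ q) i + coeff (s +ₚ t) i                 ≈⟨ +-cong (coeff-+ p q i) (coeff-+ s t i) ⟩
    (coeff p i + coeff q i) + (coeff s i + coeff t i)   ≈⟨ +-interchange _ _ _ _ ⟩
    (coeff p i + coeff s i) + (coeff q i + coeff t i)   ≈⟨ +-cong (coeff-+ p s i) (coeff-+ q t i) ⟨
    coeff (p +ₚ s) i + coeff (q +ₚ t) i                 ≈⟨ coeff-+ (p +ₚ s) (q +ₚ t) i ⟨
    coeff ((p +ₚ s) +ₚ (q +ₚ t)) i                      ∎

  ·-cong : ∀ {a b p q} → a ≈ b → p ≋ q → a ·ₚ p ≋ b ·ₚ q
  ·-cong {a} {b} {p} {q} a≈b (mk e) = mk λ i → trans (coeff-· a p i) (trans (*-cong a≈b (e i)) (sym (coeff-· b q i)))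

  ·-distribˡ : ∀ a p q → a ·ₚ (p +ₚ q) ≋ (a ·ₚ p) +ₚ (a ·ₚ q)
  ·-distribˡ a p q = mk λ i → begin
    coeff (a ·ₚ (p +ₚ q)) i                   ≈⟨ coeff-· a (p +ₚ q) i ⟩
    a * coeff (p +ₚ q) i                      ≈⟨ *-congˡ (coeff-+ p q i) ⟩
    a * (coeff p i + coeff q i)               ≈⟨ distribˡ a _ _ ⟩
    a * coeff p i + a * coeff q i             ≈⟨ +-cong (coeff-· a p i) (coeff-· a q i) ⟨
    coeff (a ·ₚ p) i + coeff (a ·ₚ q) i       ≈⟨ coeff-+ (a ·ₚ p) (a ·ₚ q) i ⟨
    coeff ((a ·ₚ p) +ₚ (a ·ₚ q)) i            ∎

  ·-distribʳ : ∀ a b p → (a + b) ·ₚ p ≋ (a ·ₚ p) +ₚ (b ·ₚ p)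
  ·-distribʳ a b p = mk λ i → begin
    coeff ((a + b) ·ₚ p) i                    ≈⟨ coeff-· (a + b) p i ⟩
    (a + b) * coeff p i                       ≈⟨ distribʳ _ a b ⟩
    a * coeff p i + b * coeff p i             ≈⟨ +-cong (coeff-· a p i) (coeff-· b p i) ⟨
    coeff (a ·ₚ p) i + coeff (b ·ₚ p) i       ≈⟨ coeff-+ (a ·ₚ p) (b ·ₚ p) i ⟨
    coeff ((a ·ₚ p) +ₚ (b ·ₚ p)) i            ∎

  ·-assoc : ∀ a b p → a ·ₚ (b ·ₚ p) ≋ (a * b) ·ₚ p
  ·-assoc a b p = mk λ i → begin
    coeff (a ·ₚ (b ·ₚ p)) i  ≈⟨ coeff-· a (b ·ₚ p) i ⟩
    a * coeff (b ·ₚ p) i     ≈⟨ *-congˡ (coeff-· b p i) ⟩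
    a * (b * coeff p i)      ≈⟨ *-assoc a b _ ⟨
    (a * b) * coeff p i      ≈⟨ coeff-· (a * b) p i ⟨
    coeff ((a * b) ·ₚ p) i   ∎

  ·-identity : ∀ p → 1# ·ₚ p ≋ p
  ·-identity p = mk λ i → trans (coeff-· 1# p i) (*-identityˡ _)

  ·-zero : ∀ p → 0# ·ₚ p ≋ 0ₚ
  ·-zero p = mk λ i → trans (coeff-· 0# p i) (zeroˡ _)

  0∷-+ : ∀ p q → (0# ∷ p) +ₚ (0# ∷ q) ≋ 0# ∷ (p +ₚ q)
  0∷-+ p q = ∷-cong (+-identityˡ 0#) ≋-refl

  *ₚ-zeroʳ : ∀ p → p *ₚ 0ₚ ≋ 0ₚ
  *ₚ-zeroʳ [] = ≋-refl
  *ₚ-zeroʳ (a ∷ p) = ∷-≋0 refl (*ₚ-zeroʳ p)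

  *ₚ-zeroˡ-≋ : ∀ p q → p ≋ 0ₚ → p *ₚ q ≋ 0ₚ
  *ₚ-zeroˡ-≋ [] q e = ≋-refl
  *ₚ-zeroˡ-≋ (a ∷ p) q e =
    ≋-trans (+ₚ-cong (·-cong (∷-≋0⇒head≈0 e) ≋-refl) (∷-cong refl (*ₚ-zeroˡ-≋ p q (∷-≋0⇒tail≋0 e))))
            (+ₚ-cong (·-zero q) (∷-≋0 refl ≋-refl))

  *ₚ-congˡ : ∀ p {q q′} → q ≋ q′ → p *ₚ q ≋ p *ₚ q′
  *ₚ-congˡ [] e = ≋-refl
  *ₚ-congˡ (a ∷ p) e = +ₚ-cong (·-cong refl e) (∷-cong refl (*ₚ-congˡ p e))

  *ₚ-congʳ : ∀ {p p′} q → p ≋ p′ → p *ₚ q ≋ p′ *ₚ q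
  *ₚ-congʳ {[]} {[]} q e = ≋-refl
  *ₚ-congʳ {[]} {b ∷ p′} q e = ≋-sym (*ₚ-zeroˡ-≋ (b ∷ p′) q (≋-sym e))
  *ₚ-congʳ {a ∷ p} {[]} q e = *ₚ-zeroˡ-≋ (a ∷ p) q e
  *ₚ-congʳ {a ∷ p} {b ∷ p′} q e =
    +ₚ-cong (·-cong (∷-injectiveˡ e) ≋-refl) (∷-cong refl (*ₚ-congʳ q (∷-injectiveʳ e)))

  *ₚ-cong : ∀ {p p′ q q′} → p ≋ p′ → q ≋ q′ → p *ₚ q ≋ p′ *ₚ q′
  *ₚ-cong {p′ = p′} {q = q} e f = ≋-trans (*ₚ-congʳ q e) (*ₚ-congˡ p′ f)

  *ₚ-distribʳ : ∀ q p p′ → (p +ₚ p′) *ₚ q ≋ (p *ₚ q) +ₚ (p′ *ₚ q)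
  *ₚ-distribʳ q [] p′ = ≋-refl
  *ₚ-distribʳ q (a ∷ p) [] = ≋-sym (+ₚ-identityʳ _)
  *ₚ-distribʳ q (a ∷ p) (b ∷ p′) =
    ≋-trans (+ₚ-cong (·-distribʳ a b q) (≋-trans (∷-cong refl (*ₚ-distribʳ q p p′)) (≋-sym (0∷-+ (p *ₚ q) (p′ *ₚ q)))))
            (+ₚ-interchange (a ·ₚ q) (b ·ₚ q) (0# ∷ (p *ₚ q)) (0# ∷ (p′ *ₚ q)))

  *ₚ-distribˡ : ∀ p q q′ → p *ₚ (q +ₚ q′) ≋ (p *ₚ q) +ₚ (p *ₚ q′)
  *ₚ-distribˡ [] q q′ = ≋-refl
  *ₚ-distribˡ (a ∷ p) q q′ =
    ≋-trans (+ₚ-cong (·-distribˡ a q q′) (≋-trans (∷-cong refl (*ₚ-distribˡ p q q′)) (≋-sym (0∷-+ (p *ₚ q) (p *ₚ q′)))))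
            (+ₚ-interchange (a ·ₚ q) (a ·ₚ q′) (0# ∷ (p *ₚ q)) (0# ∷ (p *ₚ q′)))

  ·-*ₚ : ∀ a p q → (a ·ₚ p) *ₚ q ≋ a ·ₚ (p *ₚ q)
  ·-*ₚ a [] q = ≋-refl
  ·-*ₚ a (b ∷ p) q =
    ≋-trans (+ₚ-cong (≋-sym (·-assoc a b q)) (∷-cong (sym (zeroʳ a)) (·-*ₚ a p q)))
            (≋-sym (·-distribˡ a (b ·ₚ q) (0# ∷ (p *ₚ q))))

  0∷-*ₚ : ∀ p q → (0# ∷ p) *ₚ q ≋ 0# ∷ (p *ₚ q)
  0∷-*ₚ p q = +ₚ-cong (·-zero q) ≋-refl

  *ₚ-∷ : ∀ p b q → p *ₚ (b ∷ q) ≋ (b ·ₚ p) +ₚ (0# ∷ (p *ₚ q))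
  *ₚ-∷ [] b q = ≋-sym (∷-≋0 refl ≋-refl)
  *ₚ-∷ (a ∷ p) b q = ∷-cong (+-congʳ (*-comm a b)) tail
    where
    tail : (a ·ₚ q) +ₚ (p *ₚ (b ∷ q)) ≋ (b ·ₚ p) +ₚ ((a ·ₚ q) +ₚ (0# ∷ (p *ₚ q)))
    tail = ≋-trans (+ₚ-cong ≋-refl (*ₚ-∷ p b q))
           (≋-trans (≋-sym (+ₚ-assoc (a ·ₚ q) (b ·ₚ p) _))
           (≋-trans (+ₚ-cong (+ₚ-comm (a ·ₚ q) (b ·ₚ p)) ≋-refl)
                    (+ₚ-assoc (b ·ₚ p) (a ·ₚ q) _)))

  *ₚ-comm : ∀ p q → p *ₚ q ≋ q *ₚ p
  *ₚ-comm [] q = ≋-sym (*ₚ-zeroʳ q)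
  *ₚ-comm (a ∷ p) q = ≋-trans (+ₚ-cong ≋-refl (∷-cong refl (*ₚ-comm p q))) (≋-sym (*ₚ-∷ q a p))

  *ₚ-assoc : ∀ p q s → (p *ₚ q) *ₚ s ≋ p *ₚ (q *ₚ s)
  *ₚ-assoc [] q s = ≋-refl
  *ₚ-assoc (a ∷ p) q s =
    ≋-trans (*ₚ-distribʳ s (a ·ₚ q) (0# ∷ (p *ₚ q)))
            (+ₚ-cong (·-*ₚ a q s) (≋-trans (0∷-*ₚ (p *ₚ q) s) (∷-cong refl (*ₚ-assoc p q s))))

  *ₚ-identityˡ : ∀ p → 1ₚ *ₚ p ≋ p
  *ₚ-identityˡ p = ≋-trans (+ₚ-cong (·-identity p) (∷-≋0 refl ≋-refl)) (+ₚ-identityʳ p)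

  *ₚ-identityʳ : ∀ p → p *ₚ 1ₚ ≋ p
  *ₚ-identityʳ p = ≋-trans (*ₚ-comm p 1ₚ) (*ₚ-identityˡ p)

  polynomialRing : CommutativeRing c ℓ
  polynomialRing = record
    { Carrier = Poly
    ; _≈_ = _≋_
    ; _+_ = _+ₚ_
    ; _*_ = _*ₚ_
    ; -_ = -ₚ_
    ; 0# = 0ₚ
    ; 1# = 1ₚ
    ; isCommutativeRing = record
      { isRing = record
        { +-isAbelianGroup = record
          { isGroup = record
            { isMonoid = record
              { isSemigroup = record
                { isMagma = record
                  { isEquivalence = record { refl = ≋-refl ; sym = ≋-sym ; trans = ≋-trans }
                  ; ∙-cong = +ₚ-cong }
                ; assoc = +ₚ-assoc }
              ; identity = (λ _ → ≋-refl) , +ₚ-identityʳ }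
            ; inverse = -ₚ-inverseˡ , -ₚ-inverseʳ
            ; ⁻¹-cong = -ₚ-cong }
          ; comm = +ₚ-comm }
        ; *-cong = *ₚ-cong
        ; *-assoc = *ₚ-assoc
        ; *-identity = *ₚ-identityˡ , *ₚ-identityʳ
        ; distrib = *ₚ-distribˡ , *ₚ-distribʳ }
      ; *-comm = *ₚ-comm }
    }

  _≋0? : ∀ p → Dec (p ≋ 0ₚ)
  [] ≋0? = yes ≋-refl
  (a ∷ p) ≋0? with a ≟ 0# | p ≋0?
  ... | yes a≈0 | yes p≋0 = yes (∷-≋0 a≈0 p≋0)
  ... | no a≉0  | _       = no λ e → a≉0 (∷-≋0⇒head≈0 e)
  ... | yes _   | no p≉0  = no λ e → p≉0 (∷-≋0⇒tail≋0 e)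

  1ₚ≉0ₚ : ¬ 1ₚ ≋ 0ₚ
  1ₚ≉0ₚ e = 1≉0 (∷-≋0⇒head≈0 e)

  -- Cancel the leading zero coefficients of both factors; then the product of
  -- the two lowest nonzero coefficients is a nonzero coefficient of the product.
  *ₚ-nonZero : ∀ {p q} → ¬ p ≋ 0ₚ → ¬ q ≋ 0ₚ → ¬ p *ₚ q ≋ 0ₚ
  *ₚ-nonZero {[]} p≉0 _ _ = p≉0 ≋-refl
  *ₚ-nonZero {a ∷ p} {q} p≉0 q≉0 pq≋0 with a ≟ 0#
  ... | yes a≈0 = *ₚ-nonZero (λ p≋0 → p≉0 (∷-≋0 a≈0 p≋0)) q≉0
                    (∷-≋0⇒tail≋0 (≋-trans (≋-sym (0∷-*ₚ p q)) (≋-trans (*ₚ-congʳ q (∷-cong (sym a≈0) (≋-refl {p}))) pq≋0)))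
  ... | no a≉0 = nonzeroHead q q≉0 pq≋0
    where
    nonzeroHead : ∀ q → ¬ q ≋ 0ₚ → ¬ (a ∷ p) *ₚ q ≋ 0ₚ
    nonzeroHead [] q≉0 _ = q≉0 ≋-refl
    nonzeroHead (b ∷ q) q≉0 e with b ≟ 0#
    ... | no b≉0 = *-nonZero a≉0 b≉0 (trans (sym (+-identityʳ (a * b))) (∷-≋0⇒head≈0 e))
    ... | yes b≈0 = nonzeroHead q (λ q≋0 → q≉0 (∷-≋0 b≈0 q≋0))
                      (∷-≋0⇒tail≋0 (≋-trans (≋-sym shift) (≋-trans (*ₚ-congˡ (a ∷ p) (∷-cong (sym b≈0) (≋-refl {q}))) e)))
      where
      shift : (a ∷ p) *ₚ (0# ∷ q) ≋ 0# ∷ ((a ∷ p) *ₚ q)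
      shift = ≋-trans (*ₚ-∷ (a ∷ p) 0# q) (+ₚ-cong (·-zero (a ∷ p)) ≋-refl)

module FractionField {r : ℕ} {{_ : NonZero r}} {c ℓ : Level} (F : FiniteField r c ℓ) where
  open CarlitzBC F
  open Polynomials F
  private module ℙ = CommutativeRing polynomialRing
  open import Algebra.Properties.Group ℙ.+-group using (x∙y⁻¹≈ε⇒x≈y; x≈y⇒x∙y⁻¹≈ε)
  open import Algebra.Properties.Ring ℙ.ring using ([y-z]x≈yx-zx; -‿distribˡ-*)
  open import Algebra.Solver.Ring.NaturalCoefficients.Default ℙ.commutativeSemiring
  open import Relation.Binary.Reasoning.Setoid ℙ.setoid

  *ₚ-cancelʳ : ∀ d {p q} → .(¬ d ≋ 0ₚ) → p *ₚ d ≋ q *ₚ d → p ≋ q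
  *ₚ-cancelʳ d {p} {q} d≉0 pd≋qd with (p +ₚ (-ₚ q)) ≋0?
  ... | yes p-q≋0 = x∙y⁻¹≈ε⇒x≈y p q p-q≋0
  ... | no p-q≉0 = ⊥-elim-irr (*ₚ-nonZero p-q≉0 d≉0 (≋-trans ([y-z]x≈yx-zx d p q) (x≈y⇒x∙y⁻¹≈ε pd≋qd)))

  -- The elements of K with nonzero denominator; as the proof is irrelevant, equal values give equal fractions.
  record Frac : Set (c ⊔ ℓ) where
    constructor ⟨_,_⟩
    field
      val : K
      .den≉0 : ¬ den val ≋ 0ₚ
  open Frac public

  infix 4 _≃_
  record _≃_ (x y : Frac) : Set ℓ where
    constructor mk≃
    field cross : num (val x) *ₚ den (val y) ≋ num (val y) *ₚ den (val x)
  open _≃_ public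

  infixl 6 _+ᶠ_
  infixl 7 _*ᶠ_

  -- Opaque, so that unification does not unfold sums and products of fractions.
  opaque
    _+ᶠ_ _*ᶠ_ : Frac → Frac → Frac
    ⟨ x , x≉0 ⟩ +ᶠ ⟨ y , y≉0 ⟩ = ⟨ x +ₖ y , *ₚ-nonZero x≉0 y≉0 ⟩
    ⟨ x , x≉0 ⟩ *ᶠ ⟨ y , y≉0 ⟩ = ⟨ x *ₖ y , *ₚ-nonZero x≉0 y≉0 ⟩

    -ᶠ_ : Frac → Frac
    -ᶠ ⟨ x , x≉0 ⟩ = ⟨ -ₖ x , x≉0 ⟩

    0ᶠ 1ᶠ : Frac
    0ᶠ = ⟨ 0ₖ , 1ₚ≉0ₚ ⟩
    1ᶠ = ⟨ 1ₖ , 1ₚ≉0ₚ ⟩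

    ≃-trans : ∀ {x y z} → x ≃ y → y ≃ z → x ≃ z
    ≃-trans {⟨ a /ₖ b , _ ⟩} {⟨ c′ /ₖ d , d≉0 ⟩} {⟨ e /ₖ f , _ ⟩} (mk≃ ad≋cb) (mk≃ cf≋ed) =
      mk≃ (*ₚ-cancelʳ d d≉0 (begin
        (a *ₚ f) *ₚ d  ≈⟨ solve 3 (λ a f d → (a :* f) :* d := (a :* d) :* f) ≋-refl a f d ⟩
        (a *ₚ d) *ₚ f  ≈⟨ *ₚ-congʳ f ad≋cb ⟩
        (c′ *ₚ b) *ₚ f ≈⟨ solve 3 (λ c b f → (c :* b) :* f := (c :* f) :* b) ≋-refl c′ b f ⟩
        (c′ *ₚ f) *ₚ b ≈⟨ *ₚ-congʳ b cf≋ed ⟩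
        (e *ₚ d) *ₚ b  ≈⟨ solve 3 (λ e d b → (e :* d) :* b := (e :* b) :* d) ≋-refl e d b ⟩
        (e *ₚ b) *ₚ d  ∎))

    +ᶠ-cong : ∀ {x x′ y y′} → x ≃ x′ → y ≃ y′ → x +ᶠ y ≃ x′ +ᶠ y′
    +ᶠ-cong {⟨ a /ₖ b , _ ⟩} {⟨ a′ /ₖ b′ , _ ⟩} {⟨ c′ /ₖ d , _ ⟩} {⟨ c″ /ₖ d′ , _ ⟩} (mk≃ e₁) (mk≃ e₂) = mk≃ $ begin
      ((a *ₚ d) +ₚ (c′ *ₚ b)) *ₚ (b′ *ₚ d′)
        ≈⟨ solve 6 (λ a b c d b′ d′ → ((a :* d) :+ (c :* b)) :* (b′ :* d′) := (a :* b′) :* (d :* d′) :+ (c :* d′) :* (b :* b′)) ≋-refl a b c′ d b′ d′ ⟩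
      ((a *ₚ b′) *ₚ (d *ₚ d′)) +ₚ ((c′ *ₚ d′) *ₚ (b *ₚ b′))
        ≈⟨ +ₚ-cong (*ₚ-congʳ (d *ₚ d′) e₁) (*ₚ-congʳ (b *ₚ b′) e₂) ⟩
      ((a′ *ₚ b) *ₚ (d *ₚ d′)) +ₚ ((c″ *ₚ d) *ₚ (b *ₚ b′))
        ≈⟨ solve 6 (λ a b c d b′ d′ → (a :* b) :* (d :* d′) :+ (c :* d) :* (b :* b′) := ((a :* d′) :+ (c :* b′)) :* (b :* d)) ≋-refl a′ b c″ d b′ d′ ⟩
      ((a′ *ₚ d′) +ₚ (c″ *ₚ b′)) *ₚ (b *ₚ d) ∎

    *ᶠ-cong : ∀ {x x′ y y′} → x ≃ x′ → y ≃ y′ → x *ᶠ y ≃ x′ *ᶠ y′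
    *ᶠ-cong {⟨ a /ₖ b , _ ⟩} {⟨ a′ /ₖ b′ , _ ⟩} {⟨ c′ /ₖ d , _ ⟩} {⟨ c″ /ₖ d′ , _ ⟩} (mk≃ e₁) (mk≃ e₂) = mk≃ $ begin
      (a *ₚ c′) *ₚ (b′ *ₚ d′) ≈⟨ solve 4 (λ a c b′ d′ → (a :* c) :* (b′ :* d′) := (a :* b′) :* (c :* d′)) ≋-refl a c′ b′ d′ ⟩
      (a *ₚ b′) *ₚ (c′ *ₚ d′) ≈⟨ *ₚ-cong e₁ e₂ ⟩
      (a′ *ₚ b) *ₚ (c″ *ₚ d)  ≈⟨ solve 4 (λ a c b d → (a :* b) :* (c :* d) := (a :* c) :* (b :* d)) ≋-refl a′ c″ b d ⟩
      (a′ *ₚ c″) *ₚ (b *ₚ d)  ∎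

    -ᶠ-cong : ∀ {x y} → x ≃ y → -ᶠ x ≃ -ᶠ y
    -ᶠ-cong {⟨ a /ₖ b , _ ⟩} {⟨ a′ /ₖ b′ , _ ⟩} (mk≃ e) = mk≃ $ begin
      (-ₚ a) *ₚ b′   ≈⟨ -‿distribˡ-* a b′ ⟨
      -ₚ (a *ₚ b′)   ≈⟨ -ₚ-cong e ⟩
      -ₚ (a′ *ₚ b)   ≈⟨ -‿distribˡ-* a′ b ⟩
      (-ₚ a′) *ₚ b   ∎

    +ᶠ-assoc : ∀ x y z → (x +ᶠ y) +ᶠ z ≃ x +ᶠ (y +ᶠ z)
    +ᶠ-assoc ⟨ a /ₖ b , _ ⟩ ⟨ c′ /ₖ d , _ ⟩ ⟨ e /ₖ f , _ ⟩ = mk≃ $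
      solve 6 (λ a b c d e f → (((a :* d) :+ (c :* b)) :* f :+ e :* (b :* d)) :* (b :* (d :* f))
                            := (a :* (d :* f) :+ (c :* f :+ e :* d) :* b) :* ((b :* d) :* f)) ≋-refl a b c′ d e f

    +ᶠ-comm : ∀ x y → x +ᶠ y ≃ y +ᶠ x
    +ᶠ-comm ⟨ a /ₖ b , _ ⟩ ⟨ c′ /ₖ d , _ ⟩ = mk≃ $
      solve 4 (λ a b c d → ((a :* d) :+ (c :* b)) :* (d :* b) := ((c :* b) :+ (a :* d)) :* (b :* d)) ≋-refl a b c′ d

    +ᶠ-identityˡ : ∀ x → 0ᶠ +ᶠ x ≃ x
    +ᶠ-identityˡ ⟨ a /ₖ b , _ ⟩ = mk≃ $
      solve 2 (λ a b → ((con 0 :* b) :+ (a :* con 1)) :* b := a :* (con 1 :* b)) ≋-refl a b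

    +ᶠ-identityʳ : ∀ x → x +ᶠ 0ᶠ ≃ x
    +ᶠ-identityʳ ⟨ a /ₖ b , _ ⟩ = mk≃ $
      solve 2 (λ a b → ((a :* con 1) :+ (con 0 :* b)) :* b := a :* (b :* con 1)) ≋-refl a b

    -ᶠ-inverseˡ : ∀ x → (-ᶠ x) +ᶠ x ≃ 0ᶠ
    -ᶠ-inverseˡ ⟨ a /ₖ b , _ ⟩ = mk≃ $ begin
      (((-ₚ a) *ₚ b) +ₚ (a *ₚ b)) *ₚ 1ₚ ≈⟨ *ₚ-identityʳ _ ⟩
      ((-ₚ a) *ₚ b) +ₚ (a *ₚ b)         ≈⟨ *ₚ-distribʳ b (-ₚ a) a ⟨
      ((-ₚ a) +ₚ a) *ₚ b                ≈⟨ *ₚ-congʳ b (-ₚ-inverseˡ a) ⟩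
      0ₚ                                ∎

    *ᶠ-assoc : ∀ x y z → (x *ᶠ y) *ᶠ z ≃ x *ᶠ (y *ᶠ z)
    *ᶠ-assoc ⟨ a /ₖ b , _ ⟩ ⟨ c′ /ₖ d , _ ⟩ ⟨ e /ₖ f , _ ⟩ = mk≃ $
      solve 6 (λ a b c d e f → ((a :* c) :* e) :* (b :* (d :* f)) := (a :* (c :* e)) :* ((b :* d) :* f)) ≋-refl a b c′ d e f

    *ᶠ-comm : ∀ x y → x *ᶠ y ≃ y *ᶠ x
    *ᶠ-comm ⟨ a /ₖ b , _ ⟩ ⟨ c′ /ₖ d , _ ⟩ = mk≃ $
      solve 4 (λ a b c d → (a :* c) :* (d :* b) := (c :* a) :* (b :* d)) ≋-refl a b c′ d

    *ᶠ-identityˡ : ∀ x → 1ᶠ *ᶠ x ≃ x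
    *ᶠ-identityˡ ⟨ a /ₖ b , _ ⟩ = mk≃ $
      solve 2 (λ a b → (con 1 :* a) :* b := a :* (con 1 :* b)) ≋-refl a b

    *ᶠ-identityʳ : ∀ x → x *ᶠ 1ᶠ ≃ x
    *ᶠ-identityʳ ⟨ a /ₖ b , _ ⟩ = mk≃ $
      solve 2 (λ a b → (a :* con 1) :* b := a :* (b :* con 1)) ≋-refl a b

    *ᶠ-distribʳ : ∀ x y z → (y +ᶠ z) *ᶠ x ≃ (y *ᶠ x) +ᶠ (z *ᶠ x)
    *ᶠ-distribʳ ⟨ a /ₖ b , _ ⟩ ⟨ c′ /ₖ d , _ ⟩ ⟨ e /ₖ f , _ ⟩ = mk≃ $
      solve 6 (λ a b c d e f → ((c :* f :+ e :* d) :* a) :* ((d :* b) :* (f :* b))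
                            := ((c :* a) :* (f :* b) :+ (e :* a) :* (d :* b)) :* ((d :* f) :* b)) ≋-refl a b c′ d e f

    *ᶠ-distribˡ : ∀ x y z → x *ᶠ (y +ᶠ z) ≃ (x *ᶠ y) +ᶠ (x *ᶠ z)
    *ᶠ-distribˡ ⟨ a /ₖ b , _ ⟩ ⟨ c′ /ₖ d , _ ⟩ ⟨ e /ₖ f , _ ⟩ = mk≃ $
      solve 6 (λ a b c d e f → (a :* (c :* f :+ e :* d)) :* ((b :* d) :* (b :* f))
                            := ((a :* c) :* (b :* f) :+ (a :* e) :* (b :* d)) :* (b :* (d :* f))) ≋-refl a b c′ d e f

    val-+ᶠ : ∀ x y → val (x +ᶠ y) ≡ val x +ₖ val y
    val-+ᶠ x y = ≡.refl

    val-*ᶠ : ∀ x y → val (x *ᶠ y) ≡ val x *ₖ val y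
    val-*ᶠ x y = ≡.refl

    val-negᶠ : ∀ x → val (-ᶠ x) ≡ -ₖ val x
    val-negᶠ x = ≡.refl

    val-0ᶠ : val 0ᶠ ≡ 0ₖ
    val-0ᶠ = ≡.refl

    val-1ᶠ : val 1ᶠ ≡ 1ₖ
    val-1ᶠ = ≡.refl

  fractionRing : CommutativeRing (c ⊔ ℓ) ℓ
  fractionRing = record
    { Carrier = Frac
    ; _≈_ = _≃_
    ; _+_ = _+ᶠ_
    ; _*_ = _*ᶠ_
    ; -_ = -ᶠ_
    ; 0# = 0ᶠ
    ; 1# = 1ᶠ
    ; isCommutativeRing = record
      { isRing = record
        { +-isAbelianGroup = record
          { isGroup = record
            { isMonoid = record
              { isSemigroup = record
                { isMagma = record
                  { isEquivalence = record
                    { refl = mk≃ ≋-refl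
                    ; sym = λ (mk≃ e) → mk≃ (≋-sym e)
                    ; trans = ≃-trans }
                  ; ∙-cong = +ᶠ-cong }
                ; assoc = +ᶠ-assoc }
              ; identity = +ᶠ-identityˡ , +ᶠ-identityʳ }
            ; inverse = -ᶠ-inverseˡ , λ x → ≃-trans (+ᶠ-comm x (-ᶠ x)) (-ᶠ-inverseˡ x)
            ; ⁻¹-cong = -ᶠ-cong }
          ; comm = +ᶠ-comm }
        ; *-cong = *ᶠ-cong
        ; *-assoc = *ᶠ-assoc
        ; *-identity = *ᶠ-identityˡ , *ᶠ-identityʳ
        ; distrib = *ᶠ-distribˡ , *ᶠ-distribʳ }
      ; *-comm = *ᶠ-comm }
    }

module FractionEmbedding {r : ℕ} {{_ : NonZero r}} {c ℓ : Level} (F : FiniteField r c ℓ) where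
  private module 𝔽 = FiniteField F
  open CarlitzBC F
  open Polynomials F
  open FractionField F
  open CommutativeRing fractionRing
  open FiniteSums commutativeSemiring
  open import Relation.Binary.Reasoning.Setoid setoid
  open import Algebra.Definitions.RawSemiring (Semiring.rawSemiring semiring) using (_^_)
  open import Algebra.Properties.Semiring.Mult semiring using (_×_)
  private module ℙ = CommutativeRing polynomialRing
  open import Algebra.Solver.Ring.NaturalCoefficients.Default ℙ.commutativeSemiring

  ≃⇒≈ₖ : ∀ {x y u v} → val x ≡ u → val y ≡ v → x ≃ y → u ≈ₖ v
  ≃⇒≈ₖ ≡.refl ≡.refl x≃y = coeff-≈ (cross x≃y)

  ≋⇒≃ : ∀ {x y u v} → val x ≡ u → val y ≡ v → num u *ₚ den v ≋ num v *ₚ den u → x ≃ y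
  ≋⇒≃ ≡.refl ≡.refl = mk≃

  ≈ₖ⇒≃ : ∀ {x y u v} → val x ≡ u → val y ≡ v → u ≈ₖ v → x ≃ y
  ≈ₖ⇒≃ x≡u y≡v u≈v = ≋⇒≃ x≡u y≡v (mk u≈v)

  ι : Poly → Frac
  ι p = ⟨ inj p , 1ₚ≉0ₚ ⟩

  recip : (p : Poly) → .(¬ p ≋ 0ₚ) → Frac
  recip p p≉0 = ⟨ 1ₖ ÷ₖ inj p , *ₚ-nonZero 1ₚ≉0ₚ p≉0 ⟩

  ℕ→Frac : ℕ → Frac
  ℕ→Frac n = ⟨ ℕ→K n , 1ₚ≉0ₚ ⟩

  -- Opaque, so that unification does not unfold the case distinction.
  opaque
    when≡ᶠ : ℕ → ℕ → Frac → Frac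
    when≡ᶠ a b x = if ⌊ a ℕ.≟ b ⌋ then x else 0#

    val-when≡ᶠ : ∀ a b x → val (when≡ᶠ a b x) ≡ when≡ a b (val x)
    val-when≡ᶠ a b x with ⌊ a ℕ.≟ b ⌋
    ... | true = ≡.refl
    ... | false = val-0ᶠ

    when≡ᶠ-≡ : ∀ {a b} x → a ≡ b → when≡ᶠ a b x ≈ x
    when≡ᶠ-≡ {a} {b} x a≡b with a ℕ.≟ b
    ... | yes _ = refl
    ... | no a≢b = ⊥-elim (a≢b a≡b)

    when≡ᶠ-≢ : ∀ {a b} x → a ≢ b → when≡ᶠ a b x ≈ 0#
    when≡ᶠ-≢ {a} {b} x a≢b with a ℕ.≟ b
    ... | yes a≡b = ⊥-elim (a≢b a≡b)
    ... | no _ = refl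

  -- Follows the recursion of Σ≤, which starts from f 0 rather than from 0.
  Σ≤ᶠ : ℕ → (ℕ → Frac) → Frac
  Σ≤ᶠ zero f = f 0
  Σ≤ᶠ (suc n) f = Σ≤ᶠ n f + f (suc n)

  val-sum : ∀ n (f : ℕ → Frac) {g} → (∀ i → val (f i) ≡ g i) → val (sum n f) ≡ Σ< n g
  val-sum zero f e = val-0ᶠ
  val-sum (suc n) f e rewrite val-+ᶠ (sum n f) (f n) | val-sum n f e | e n = ≡.refl

  val-sum-suc : ∀ n (f : ℕ → Frac) {g} → (∀ i → val (f i) ≡ g i) → val (sum n (λ i → f (suc i))) ≡ Σ1≤ n g
  val-sum-suc zero f e = val-0ᶠ
  val-sum-suc (suc n) f e rewrite val-+ᶠ (sum n (λ i → f (suc i))) (f (suc n)) | val-sum-suc n f e | e (suc n) = ≡.refl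

  val-Σ≤ᶠ : ∀ n (f : ℕ → Frac) {g} → (∀ i → val (f i) ≡ g i) → val (Σ≤ᶠ n f) ≡ Σ≤ n g
  val-Σ≤ᶠ zero f e = e 0
  val-Σ≤ᶠ (suc n) f e rewrite val-+ᶠ (Σ≤ᶠ n f) (f (suc n)) | val-Σ≤ᶠ n f e | e (suc n) = ≡.refl

  Σ≤ᶠ≈sum : ∀ n (f : ℕ → Frac) → Σ≤ᶠ n f ≈ sum (suc n) f
  Σ≤ᶠ≈sum zero f = sym (+-identityˡ (f 0))
  Σ≤ᶠ≈sum (suc n) f = +-congʳ (Σ≤ᶠ≈sum n f)

  val-listSum : ∀ {A : Set} (φ : A → Frac) {ψ} → (∀ x → val (φ x) ≡ ψ x) →
                ∀ xs → val (listSum (map φ xs)) ≡ sumList (map ψ xs)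
  val-listSum φ e [] = val-0ᶠ
  val-listSum φ e (x ∷ xs) rewrite val-+ᶠ (φ x) (listSum (map φ xs)) | val-listSum φ e xs | e x = ≡.refl

  val-^ : ∀ x n → val (x ^ n) ≡ val x ^ₖ n
  val-^ x zero = val-1ᶠ
  val-^ x (suc n) rewrite val-*ᶠ x (x ^ n) | val-^ x n = ≡.refl

  recip-* : ∀ p q .(p≉0 : ¬ p ≋ 0ₚ) .(q≉0 : ¬ q ≋ 0ₚ) →
            recip (p *ₚ q) (*ₚ-nonZero p≉0 q≉0) ≈ recip p p≉0 * recip q q≉0
  recip-* p q _ _ = ≋⇒≃ ≡.refl (val-*ᶠ _ _) (solve 2 (λ p q → (con 1 :* con 1) :* ((con 1 :* p) :* (con 1 :* q))
                                   := ((con 1 :* con 1) :* (con 1 :* con 1)) :* (con 1 :* (p :* q))) ≋-refl p q)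

  recip-1 : recip 1ₚ 1ₚ≉0ₚ ≈ 1#
  recip-1 = ≋⇒≃ ≡.refl val-1ᶠ (solve 0 ((con 1 :* con 1) :* con 1 := con 1 :* (con 1 :* con 1)) ≋-refl)

  ι*recip : ∀ p .(p≉0 : ¬ p ≋ 0ₚ) → ι p * recip p p≉0 ≈ 1#
  ι*recip p _ = ≋⇒≃ (val-*ᶠ _ _) val-1ᶠ
    (solve 1 (λ p → (p :* (con 1 :* con 1)) :* con 1 := con 1 :* (con 1 :* (con 1 :* p))) ≋-refl p)

  ι*÷ : ∀ x p .(x≉0 : ¬ den x ≋ 0ₚ) .(p≉0 : ¬ p ≋ 0ₚ) →
        ι p * ⟨ x ÷ₖ inj p , *ₚ-nonZero x≉0 p≉0 ⟩ ≈ ⟨ x , x≉0 ⟩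
  ι*÷ (a /ₖ b) p _ _ = ≋⇒≃ (val-*ᶠ _ _) ≡.refl
    (solve 3 (λ p a b → (p :* (a :* con 1)) :* b := a :* (con 1 :* (b :* p))) ≋-refl p a b)

  ℕ→Frac≈× : ∀ n → ℕ→Frac n ≈ n × 1#
  ℕ→Frac≈× zero = ≋⇒≃ ≡.refl val-0ᶠ (*ₚ-zeroˡ-≋ (𝔽.0# ∷ []) 1ₚ (∷-≋0 𝔽.refl ≋-refl))
  ℕ→Frac≈× (suc n) = begin
    ℕ→Frac (suc n)    ≈⟨ ≋⇒≃ ≡.refl val-1+ℕ→Frac (≋-trans lhs (≋-sym rhs)) ⟩
    1# + ℕ→Frac n     ≈⟨ +-congˡ (ℕ→Frac≈× n) ⟩
    1# + n × 1#       ∎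
    where
    a = ℕ→𝔽 n
    val-1+ℕ→Frac : val (1# + ℕ→Frac n) ≡ 1ₖ +ₖ ℕ→K n
    val-1+ℕ→Frac = ≡.trans (val-+ᶠ 1# (ℕ→Frac n)) (≡.cong (_+ₖ ℕ→K n) val-1ᶠ)
    lhs : ((𝔽.1# 𝔽.+ a) ∷ []) *ₚ (1ₚ *ₚ 1ₚ) ≋ (𝔽.1# 𝔽.+ a) ∷ []
    lhs = ≋-trans (*ₚ-congˡ ((𝔽.1# 𝔽.+ a) ∷ []) (*ₚ-identityʳ 1ₚ)) (*ₚ-identityʳ _)
    rhs : ((1ₚ *ₚ 1ₚ) +ₚ ((a ∷ []) *ₚ 1ₚ)) *ₚ 1ₚ ≋ (𝔽.1# 𝔽.+ a) ∷ []
    rhs = ≋-trans (*ₚ-identityʳ _) (+ₚ-cong (*ₚ-identityʳ 1ₚ) (*ₚ-identityʳ (a ∷ [])))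

module CarlitzNonvanishing {r : ℕ} {{_ : NonZero r}} {c ℓ : Level} (F : FiniteField r c ℓ) (1<r : 1 < r) where
  open FiniteField F using (_≈_; 0#; 1#; -_; _+_; refl; trans; sym; +-cong; +-congˡ; -‿cong; +-identityʳ; 1≉0; ring)
  open CarlitzBC F
  open Polynomials F
  open import Algebra.Properties.Ring ring using (-0#≈0#)

  coeff-T^-self : ∀ m → coeff (T^ m) m ≈ 1#
  coeff-T^-self zero = refl
  coeff-T^-self (suc m) = coeff-T^-self m

  coeff-T^1 : ∀ m → 1 < m → coeff (T^ 1) m ≈ 0#
  coeff-T^1 (suc zero) (s≤s ())
  coeff-T^1 (suc (suc m)) _ = refl

  -- The coefficient of T^{r^i} in [i] = T^{r^i} - T is 1.
  bracket≉0 : ∀ i → 1 ≤ i → ¬ bracket i ≋ 0ₚ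
  bracket≉0 i 1≤i (mk [i]≈0) = 1≉0 (trans (sym leading) ([i]≈0 (r ^ℕ i)))
    where
    1<rⁱ : 1 < r ^ℕ i
    1<rⁱ = ≤-trans 1<r (≤-trans (≤-reflexive (≡.sym (ℕ.*-identityʳ r))) (^-monoʳ-≤ r 1≤i))
    leading : coeff (bracket i) (r ^ℕ i) ≈ 1#
    leading = trans (coeff-+ (T^ (r ^ℕ i)) (-ₚ T^ 1) (r ^ℕ i))
              (trans (+-cong (coeff-T^-self (r ^ℕ i)) (trans (coeff-neg (T^ 1) (r ^ℕ i)) (-‿cong (coeff-T^1 (r ^ℕ i) 1<rⁱ))))
              (trans (+-congˡ -0#≈0#) (+-identityʳ 1#)))

  ^ₚ-nonZero : ∀ {p} n → ¬ p ≋ 0ₚ → ¬ p ^ₚ n ≋ 0ₚ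
  ^ₚ-nonZero zero p≉0 = 1ₚ≉0ₚ
  ^ₚ-nonZero (suc n) p≉0 = *ₚ-nonZero p≉0 (^ₚ-nonZero n p≉0)

  D≉0 : ∀ i → ¬ D i ≋ 0ₚ
  D≉0 zero = 1ₚ≉0ₚ
  D≉0 (suc i) = *ₚ-nonZero (bracket≉0 (suc i) (s≤s z≤n)) (^ₚ-nonZero r (D≉0 i))

  Π-aux≉0 : ∀ fuel n j → ¬ Π-aux fuel n j ≋ 0ₚ
  Π-aux≉0 zero n j = 1ₚ≉0ₚ
  Π-aux≉0 (suc fuel) n j = *ₚ-nonZero (^ₚ-nonZero (n % r) (D≉0 j)) (Π-aux≉0 fuel (n / r) (suc j))

  Π≉0 : ∀ n → ¬ Π n ≋ 0ₚ
  Π≉0 n = Π-aux≉0 n n 0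

  prodD≉0 : ∀ N {k} (v : Vec ℕ k) → ¬ prodD N v ≋ 0ₚ
  prodD≉0 N []ᵥ = 1ₚ≉0ₚ
  prodD≉0 N (i ∷ᵥ v) = *ₚ-nonZero (D≉0 (N +ℕ i)) (prodD≉0 N v)

module CarlitzSeries {r : ℕ} {{_ : NonZero r}} {c ℓ : Level} (F : FiniteField r c ℓ) (1<r : 1 < r) (N : ℕ) where
  open CarlitzBC F
  open FractionField F
  open CommutativeRing fractionRing
  open FiniteSums commutativeSemiring
  open Convolution fractionRing
  open FractionEmbedding F
  open CarlitzNonvanishing F 1<r
  open import Algebra.Definitions.RawSemiring (Semiring.rawSemiring semiring) using (_^_)
  open import Algebra.Properties.Ring ring using (-‿distribˡ-*)
  open import Algebra.Properties.AbelianGroup +-abelianGroup using (xyx⁻¹≈y)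
  open import Algebra.Properties.CommutativeSemigroup *-commutativeSemigroup using () renaming (interchange to *-interchange)
  open import Relation.Binary.Reasoning.Setoid setoid

  n<rⁿ : ∀ n → n < r ^ℕ n
  n<rⁿ zero = s≤s z≤n
  n<rⁿ (suc n) = <-≤-trans (s≤s (n<rⁿ n)) (^-monoʳ-< r 1<r (n<1+n n))

  s : ℕ
  s = r ^ℕ N

  rᴺ⁺ʲ≡s⇒j≡0 : ∀ j → r ^ℕ (N +ℕ j) ≡ s → j ≡ 0
  rᴺ⁺ʲ≡s⇒j≡0 zero _ = ≡.refl
  rᴺ⁺ʲ≡s⇒j≡0 (suc j) e = ⊥-elim (<-irrefl (≡.sym e) (^-monoʳ-< r 1<r (m<m+n N z<s)))

  D⁻¹ : ℕ → Frac
  D⁻¹ i = recip (D i) (D≉0 i)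

  eTerm : ℕ → ℕ → Frac
  eTerm l i = when≡ᶠ (r ^ℕ i) l (D⁻¹ i)

  eTerm-beyond : ∀ {l i} → l < i → eTerm l i ≈ 0#
  eTerm-beyond {l} {i} l<i = when≡ᶠ-≢ (D⁻¹ i) λ e → <-irrefl (≡.sym e) (<-trans l<i (n<rⁿ i))

  denom : ℕ → Frac
  denom l = Σ≤ᶠ l (eTerm l) - sum N (eTerm l)

  val-denom : ∀ l → val (denom l) ≡ denom-coeff N l
  val-denom l
    rewrite val-+ᶠ (Σ≤ᶠ l (eTerm l)) (- sum N (eTerm l)) | val-negᶠ (sum N (eTerm l))
          | val-Σ≤ᶠ l (eTerm l) (λ i → val-when≡ᶠ (r ^ℕ i) l (D⁻¹ i))
          | val-sum N (eTerm l) (λ i → val-when≡ᶠ (r ^ℕ i) l (D⁻¹ i)) = ≡.refl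

  denom≈tail : ∀ l → denom l ≈ sum (suc l) (λ j → eTerm l (N +ℕ j))
  denom≈tail l = begin
    denom l                                                   ≈⟨ +-congʳ (Σ≤ᶠ≈sum l (eTerm l)) ⟩
    sum (suc l) (eTerm l) - sum N (eTerm l)                   ≈⟨ +-congʳ (sum-extend (suc l) (N +ℕ suc l) _ (m≤n+m (suc l) N)
                                                                     λ i l<i _ → eTerm-beyond l<i) ⟨
    sum (N +ℕ suc l) (eTerm l) - sum N (eTerm l)              ≈⟨ +-congʳ (sum-split N (suc l) (eTerm l)) ⟩
    sum N (eTerm l) + sum (suc l) (λ j → eTerm l (N +ℕ j)) - sum N (eTerm l) ≈⟨ xyx⁻¹≈y _ _ ⟩
    sum (suc l) (λ j → eTerm l (N +ℕ j))                      ∎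

  denom-below : ∀ l → l < s → denom l ≈ 0#
  denom-below l l<s = trans (denom≈tail l) (sum-zero (suc l) λ j _ →
    when≡ᶠ-≢ (D⁻¹ (N +ℕ j)) λ e → <-irrefl (≡.sym e) (<-≤-trans l<s (^-monoʳ-≤ r (m≤m+n N j))))

  denom-s : denom s ≈ D⁻¹ N
  denom-s = begin
    denom s                              ≈⟨ denom≈tail s ⟩
    sum (suc s) (λ j → eTerm s (N +ℕ j)) ≈⟨ sum-δ (suc s) _ 0 (s≤s z≤n) (λ j _ j≢0 →
                                              when≡ᶠ-≢ (D⁻¹ (N +ℕ j)) λ e → j≢0 (rᴺ⁺ʲ≡s⇒j≡0 j e)) ⟩
    eTerm s (N +ℕ 0)                     ≡⟨ ≡.cong (eTerm s) (ℕ.+-identityʳ N) ⟩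
    eTerm s N                            ≈⟨ when≡ᶠ-≡ (D⁻¹ N) ≡.refl ⟩
    D⁻¹ N                                ∎

  -Dₙ : Frac
  -Dₙ = - ι (D N)

  -Dₙ*D⁻¹ₙ : -Dₙ * D⁻¹ N ≈ - 1#
  -Dₙ*D⁻¹ₙ = trans (sym (-‿distribˡ-* _ _)) (-‿cong (ι*recip (D N) (D≉0 N)))

  -- x^{-s}(e_C(x) - ∑_{i<N} x^{r^i}/D_i), normalised to constant term -1.
  g : ℕ → Frac
  g j = -Dₙ * denom (s +ℕ j)

  g₀≈-1 : g 0 ≈ - 1#
  g₀≈-1 = trans (*-congˡ (trans (reflexive (≡.cong denom (ℕ.+-identityʳ s))) denom-s)) -Dₙ*D⁻¹ₙ

  denomPower : ℕ → ℕ → Frac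
  denomPower zero = δ
  denomPower (suc k) = denom ⊛ denomPower k

  denomPower-below : ∀ k t → t < k *ℕ s → denomPower k t ≈ 0#
  denomPower-below (suc k) t t<s+ks = sum-zero (suc t) term
    where
    term : ∀ l → l < suc t → denom l * denomPower k (t ∸ l) ≈ 0#
    term l l<1+t with l ℕ.<? s
    ... | yes l<s = trans (*-congʳ (denom-below l l<s)) (zeroˡ _)
    ... | no l≮s = trans (*-congˡ (denomPower-below k (t ∸ l)
                           (m∸n<o (≤-pred l<1+t) (<-≤-trans t<s+ks (+-monoˡ-≤ (k *ℕ s) (≮⇒≥ l≮s)))))) (zeroʳ _)

  normalizedPower : ℕ → ℕ → Frac
  normalizedPower k n = -Dₙ ^ k * denomPower k (n +ℕ k *ℕ s)

  normalizedPower-zero : ∀ n → normalizedPower 0 n ≈ δ n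
  normalizedPower-zero n = trans (*-identityˡ _) (reflexive (≡.cong δ (ℕ.+-identityʳ n)))

  normalizedPower-suc : ∀ k n → normalizedPower (suc k) n ≈ (g ⊛ normalizedPower k) n
  normalizedPower-suc k n = begin
    (-Dₙ * -Dₙ ^ k) * (denom ⊛ denomPower k) (n +ℕ (s +ℕ k *ℕ s))
      ≈⟨ *-congˡ (⊛-shift s (k *ℕ s) denom-below (denomPower-below k) n) ⟩
    (-Dₙ * -Dₙ ^ k) * sum (suc n) (λ j → denom (s +ℕ j) * denomPower k ((n ∸ j) +ℕ k *ℕ s))
      ≈⟨ *-distribˡ-sum (suc n) _ _ ⟩
    sum (suc n) (λ j → (-Dₙ * -Dₙ ^ k) * (denom (s +ℕ j) * denomPower k ((n ∸ j) +ℕ k *ℕ s)))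
      ≈⟨ sum-cong (suc n) (λ j → *-interchange -Dₙ (-Dₙ ^ k) (denom (s +ℕ j)) _) ⟩
    (g ⊛ normalizedPower k) n ∎

module TupleSums {r : ℕ} {{_ : NonZero r}} {c ℓ : Level} (F : FiniteField r c ℓ) (1<r : 1 < r) (N : ℕ) where
  open CarlitzBC F
  open FractionField F
  open CommutativeRing fractionRing
  open FiniteSums commutativeSemiring
  open Convolution fractionRing
  open FractionEmbedding F
  open CarlitzNonvanishing F 1<r
  open CarlitzSeries F 1<r N
  open import Relation.Binary.Reasoning.Setoid setoid

  tupleTerm : ℕ → ∀ {k} → Vec ℕ k → Frac
  tupleTerm t v = when≡ᶠ (sumPowers N v) t (recip (prodD N v) (prodD≉0 N v))

  tupleSum : ℕ → ℕ → ℕ → Frac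
  tupleSum k B t = listSum (map (tupleTerm t) (allVecs k B))

  val-tupleSum : ∀ k n → val (tupleSum k (n +ℕ k *ℕ s) (n +ℕ k *ℕ s)) ≡ innerSum N k n
  val-tupleSum k n = val-listSum (tupleTerm B) (λ v → val-when≡ᶠ (sumPowers N v) B _) (allVecs k B)
    where B = n +ℕ k *ℕ s

  tupleTerm-∷ : ∀ t j {k} (v : Vec ℕ k) → r ^ℕ (N +ℕ j) ≤ t →
                tupleTerm t (j ∷ᵥ v) ≈ D⁻¹ (N +ℕ j) * tupleTerm (t ∸ r ^ℕ (N +ℕ j)) v
  tupleTerm-∷ t j v a≤t with sumPowers N v ℕ.≟ t ∸ r ^ℕ (N +ℕ j)
  ... | yes b≡t-a = begin
    tupleTerm t (j ∷ᵥ v)                      ≈⟨ when≡ᶠ-≡ _ (≡.trans (≡.cong (a +ℕ_) b≡t-a) (m+[n∸m]≡n a≤t)) ⟩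
    recip (prodD N (j ∷ᵥ v)) (prodD≉0 N (j ∷ᵥ v)) ≈⟨ recip-* (D (N +ℕ j)) (prodD N v) (D≉0 (N +ℕ j)) (prodD≉0 N v) ⟩
    D⁻¹ (N +ℕ j) * recip (prodD N v) (prodD≉0 N v) ≈⟨ *-congˡ (when≡ᶠ-≡ _ b≡t-a) ⟨
    D⁻¹ (N +ℕ j) * tupleTerm (t ∸ a) v        ∎
    where a = r ^ℕ (N +ℕ j)
  ... | no b≢t-a = begin
    tupleTerm t (j ∷ᵥ v)
      ≈⟨ when≡ᶠ-≢ _ (λ a+b≡t → b≢t-a (≡.trans (≡.sym (m+n∸m≡n a _)) (≡.cong (_∸ a) a+b≡t))) ⟩
    0#                                        ≈⟨ zeroʳ _ ⟨
    D⁻¹ (N +ℕ j) * 0#                         ≈⟨ *-congˡ (when≡ᶠ-≢ _ b≢t-a) ⟨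
    D⁻¹ (N +ℕ j) * tupleTerm (t ∸ a) v        ∎
    where a = r ^ℕ (N +ℕ j)

  tupleTerm-∷-beyond : ∀ t j {k} (v : Vec ℕ k) → t < r ^ℕ (N +ℕ j) → tupleTerm t (j ∷ᵥ v) ≈ 0#
  tupleTerm-∷-beyond t j v t<a =
    when≡ᶠ-≢ _ λ a+b≡t → <-irrefl ≡.refl (<-≤-trans t<a (≤-trans (m≤m+n _ _) (≤-reflexive a+b≡t)))

  tupleSum-suc : ∀ k B t → tupleSum (suc k) B t ≈ sum (suc B) (λ j → listSum (map (λ v → tupleTerm t (j ∷ᵥ v)) (allVecs k B)))
  tupleSum-suc k B t = begin
    listSum (map (tupleTerm t) (concatMap (λ j → map (j ∷ᵥ_) (allVecs k B)) (upTo (suc B))))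
      ≈⟨ listSum-map-concatMap (λ j → map (j ∷ᵥ_) (allVecs k B)) (upTo (suc B)) (tupleTerm t) ⟩
    listSum (map (λ j → listSum (map (tupleTerm t) (map (j ∷ᵥ_) (allVecs k B)))) (upTo (suc B)))
      ≈⟨ listSum-map-applyUpTo id (suc B) _ ⟩
    sum (suc B) (λ j → listSum (map (tupleTerm t) (map (j ∷ᵥ_) (allVecs k B))))
      ≈⟨ sum-cong (suc B) (λ j → reflexive (≡.cong listSum (≡.sym (map-∘ (allVecs k B))))) ⟩
    sum (suc B) (λ j → listSum (map (λ v → tupleTerm t (j ∷ᵥ v)) (allVecs k B))) ∎

  -- The j-th slice of (denom ⊛ denomPower k) t: the terms coming from x^{r^{N+j}}/D_{N+j}.
  slice : ℕ → ℕ → ℕ → Frac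
  slice k t j = sum (suc t) (λ l → eTerm l (N +ℕ j) * denomPower k (t ∸ l))

  slice-≤ : ∀ k t j → r ^ℕ (N +ℕ j) ≤ t → slice k t j ≈ D⁻¹ (N +ℕ j) * denomPower k (t ∸ r ^ℕ (N +ℕ j))
  slice-≤ k t j a≤t =
    trans (sum-δ (suc t) _ a (s≤s a≤t) λ l _ l≢a → trans (*-congʳ (when≡ᶠ-≢ _ λ a≡l → l≢a (≡.sym a≡l))) (zeroˡ _))
          (*-congʳ (when≡ᶠ-≡ _ ≡.refl))
    where a = r ^ℕ (N +ℕ j)

  slice-> : ∀ k t j → t < r ^ℕ (N +ℕ j) → slice k t j ≈ 0#
  slice-> k t j t<a = sum-zero (suc t) λ l l<1+t →
    trans (*-congʳ (when≡ᶠ-≢ _ λ a≡l → <-irrefl (≡.sym a≡l) (≤-<-trans (≤-pred l<1+t) t<a))) (zeroˡ _)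

  denomPower-suc≈slices : ∀ k B t → t ≤ B → denomPower (suc k) t ≈ sum (suc B) (slice k t)
  denomPower-suc≈slices k B t t≤B = begin
    sum (suc t) (λ l → denom l * denomPower k (t ∸ l))
      ≈⟨ sum-cong< (suc t) (λ l l<1+t → *-congʳ (trans (denom≈tail l) (sym (sum-extend (suc l) (suc B) _ (s≤s (≤-trans (≤-pred l<1+t) t≤B))
                                                   λ j l<j _ → eTerm-beyond (<-≤-trans l<j (m≤n+m j N)))))) ⟩
    sum (suc t) (λ l → sum (suc B) (λ j → eTerm l (N +ℕ j)) * denomPower k (t ∸ l))
      ≈⟨ sum-cong (suc t) (λ l → *-distribʳ-sum (suc B) _ _) ⟩
    sum (suc t) (λ l → sum (suc B) (λ j → eTerm l (N +ℕ j) * denomPower k (t ∸ l)))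
      ≈⟨ sum-swap (suc t) (suc B) _ ⟩
    sum (suc B) (slice k t) ∎

  tupleSum≈denomPower : ∀ k B t → t ≤ B → tupleSum k B t ≈ denomPower k t
  tupleSum≈denomPower zero B t t≤B = trans (+-identityʳ _) (empty t)
    where
    empty : ∀ t → tupleTerm t []ᵥ ≈ δ t
    empty zero = trans (when≡ᶠ-≡ _ ≡.refl) recip-1
    empty (suc t) = when≡ᶠ-≢ _ λ ()
  tupleSum≈denomPower (suc k) B t t≤B = begin
    tupleSum (suc k) B t                                                       ≈⟨ tupleSum-suc k B t ⟩
    sum (suc B) (λ j → listSum (map (λ v → tupleTerm t (j ∷ᵥ v)) (allVecs k B))) ≈⟨ sum-cong (suc B) slice-j ⟩
    sum (suc B) (slice k t)                                                    ≈⟨ denomPower-suc≈slices k B t t≤B ⟨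
    denomPower (suc k) t                                                       ∎
    where
    slice-j : ∀ j → listSum (map (λ v → tupleTerm t (j ∷ᵥ v)) (allVecs k B)) ≈ slice k t j
    slice-j j with r ^ℕ (N +ℕ j) ℕ.≤? t
    ... | yes a≤t = begin
      listSum (map (λ v → tupleTerm t (j ∷ᵥ v)) (allVecs k B))
        ≈⟨ listSum-map-cong (allVecs k B) (λ v → tupleTerm-∷ t j v a≤t) ⟩
      listSum (map (λ v → D⁻¹ (N +ℕ j) * tupleTerm (t ∸ a) v) (allVecs k B))
        ≈⟨ *-distribˡ-listSum (allVecs k B) _ _ ⟨
      D⁻¹ (N +ℕ j) * tupleSum k B (t ∸ a)
        ≈⟨ *-congˡ (tupleSum≈denomPower k B (t ∸ a) (≤-trans (m∸n≤m t a) t≤B)) ⟩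
      D⁻¹ (N +ℕ j) * denomPower k (t ∸ a)
        ≈⟨ slice-≤ k t j a≤t ⟨
      slice k t j ∎
      where a = r ^ℕ (N +ℕ j)
    ... | no a≰t = trans (listSum-map-zero (allVecs k B) λ v → tupleTerm-∷-beyond t j v (≰⇒> a≰t))
                         (sym (slice-> k t j (≰⇒> a≰t)))

module BernoulliCarlitz {r : ℕ} {{_ : NonZero r}} {c ℓ : Level} (F : FiniteField r c ℓ) (1<r : 1 < r) (N : ℕ)
                        (BC : ℕ → CarlitzBC.K F) (isBC : CarlitzBC.IsBC F N BC) where
  open CarlitzBC F
  open Polynomials F using (_≋_; coeff-≈; *ₚ-nonZero)
  open FractionField F
  open CommutativeRing fractionRing
  open FiniteSums commutativeSemiring
  open Convolution fractionRing
  open FractionEmbedding F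
  open CarlitzNonvanishing F 1<r
  open CarlitzSeries F 1<r N
  open TupleSums F 1<r N
  open ConvolutionPowers g g₀≈-1 normalizedPower normalizedPower-zero normalizedPower-suc
  open import Algebra.Properties.Ring ring using (-0#≈0#)
  open import Algebra.Definitions.RawSemiring (Semiring.rawSemiring semiring) using (_^_)
  open import Algebra.Properties.CommutativeSemigroup *-commutativeSemigroup using (x∙yz≈y∙xz)
  open import Relation.Binary.Reasoning.Setoid setoid

  BC≉0 : ∀ j → ¬ den (BC j) ≋ 0ₚ
  BC≉0 j e = proj₁ isBC j (coeff-≈ e)

  A : ℕ → Frac
  A j = ⟨ BC j ÷ₖ inj (Π j) , *ₚ-nonZero (BC≉0 j) (Π≉0 j) ⟩

  A⊛denom : ∀ m → (A ⊛ denom) m ≈ when≡ᶠ m s (D⁻¹ N)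
  A⊛denom m = trans (sym (Σ≤ᶠ≈sum m terms))
                    (≈ₖ⇒≃ (val-Σ≤ᶠ m terms val-terms) (val-when≡ᶠ m s (D⁻¹ N)) (proj₂ isBC m))
    where
    terms : ℕ → Frac
    terms j = A j * denom (m ∸ j)
    val-terms : ∀ j → val (terms j) ≡ (BC j ÷ₖ inj (Π j)) *ₖ denom-coeff N (m ∸ j)
    val-terms j = ≡.trans (val-*ᶠ (A j) (denom (m ∸ j))) (≡.cong (val (A j) *ₖ_) (val-denom (m ∸ j)))

  A⊛g≈-δ : ∀ n → (A ⊛ g) n ≈ - δ n
  A⊛g≈-δ n = begin
    sum (suc n) (λ j → A j * (-Dₙ * denom (s +ℕ (n ∸ j))))
      ≈⟨ sum-cong (suc n) (λ j → x∙yz≈y∙xz (A j) -Dₙ _) ⟩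
    sum (suc n) (λ j → -Dₙ * (A j * denom (s +ℕ (n ∸ j))))
      ≈⟨ *-distribˡ-sum (suc n) -Dₙ _ ⟨
    -Dₙ * sum (suc n) (λ j → A j * denom (s +ℕ (n ∸ j)))
      ≈⟨ *-congˡ (sum-cong< (suc n) λ j j<1+n → *-congˡ (reflexive (≡.cong denom (≡.sym (+-∸-assoc s (≤-pred j<1+n)))))) ⟩
    -Dₙ * sum (suc n) (λ j → A j * denom ((s +ℕ n) ∸ j))
      ≈⟨ *-congˡ (sum-extend (suc n) (suc (s +ℕ n)) _ (s≤s (m≤n+m n s)) beyond) ⟨
    -Dₙ * (A ⊛ denom) (s +ℕ n)
      ≈⟨ *-congˡ (A⊛denom (s +ℕ n)) ⟩
    -Dₙ * when≡ᶠ (s +ℕ n) s (D⁻¹ N)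
      ≈⟨ leading n ⟩
    - δ n ∎
    where
    beyond : ∀ j → suc n ≤ j → j < suc (s +ℕ n) → A j * denom ((s +ℕ n) ∸ j) ≈ 0#
    beyond j n<j j≤s+n = trans (*-congˡ (denom-below _ (m∸n<o (≤-pred j≤s+n)
                           (<-≤-trans (≤-reflexive (≡.cong suc (ℕ.+-comm s n))) (+-monoˡ-≤ s n<j))))) (zeroʳ _)
    leading : ∀ n → -Dₙ * when≡ᶠ (s +ℕ n) s (D⁻¹ N) ≈ - δ n
    leading zero = trans (*-congˡ (when≡ᶠ-≡ _ (ℕ.+-identityʳ s))) -Dₙ*D⁻¹ₙ
    leading (suc n) = trans (*-congˡ (when≡ᶠ-≢ _ λ e → <-irrefl (≡.sym e) (m<m+n s (s≤s z≤n))))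
                            (trans (zeroʳ -Dₙ) (sym -0#≈0#))

  formulaTerm : ℕ → ℕ → Frac
  formulaTerm n k = (ℕ→Frac (suc n C suc k) * -Dₙ ^ k) * tupleSum k (n +ℕ k *ℕ s) (n +ℕ k *ℕ s)

  formulaᶠ : ℕ → Frac
  formulaᶠ n = ι (Π n) * sum n (λ k → formulaTerm n (suc k))

  val-formulaᶠ : ∀ n → val (formulaᶠ n) ≡ formula N n
  val-formulaᶠ n = ≡.trans (val-*ᶠ (ι (Π n)) _) (≡.cong (inj (Π n) *ₖ_) (val-sum-suc n (formulaTerm n) val-term))
    where
    val-term : ∀ k → val (formulaTerm n k) ≡ (ℕ→K (suc n C suc k) *ₖ ((-ₖ inj (D N)) ^ₖ k)) *ₖ innerSum N k n
    val-term k
      rewrite val-*ᶠ (ℕ→Frac (suc n C suc k) * -Dₙ ^ k) (tupleSum k (n +ℕ k *ℕ s) (n +ℕ k *ℕ s))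
            | val-*ᶠ (ℕ→Frac (suc n C suc k)) (-Dₙ ^ k) | val-^ -Dₙ k | val-negᶠ (ι (D N)) | val-tupleSum k n = ≡.refl

  formulaTerm≈ : ∀ n k → formulaTerm n k ≈ binomial (suc n) (suc k) * normalizedPower k n
  formulaTerm≈ n k = begin
    (ℕ→Frac (suc n C suc k) * -Dₙ ^ k) * tupleSum k B B
      ≈⟨ *-cong (*-congʳ (ℕ→Frac≈× (suc n C suc k))) (tupleSum≈denomPower k B B ≤-refl) ⟩
    (binomial (suc n) (suc k) * -Dₙ ^ k) * denomPower k B
      ≈⟨ *-assoc _ _ _ ⟩
    binomial (suc n) (suc k) * normalizedPower k n ∎
    where B = n +ℕ k *ℕ s

  geometricSum≈formula : ∀ n → 1 ≤ n → ι (Π n) * geometricSum n n ≈ formulaᶠ n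
  geometricSum≈formula n@(suc _) _ = *-congˡ (begin
    geometricSum n n
      ≈⟨ sum-suc n _ ⟩
    binomial (suc n) 1 * normalizedPower 0 n + sum n (λ k → binomial (suc n) (suc (suc k)) * normalizedPower (suc k) n)
      ≈⟨ +-congʳ (trans (*-congˡ (normalizedPower-zero n)) (zeroʳ _)) ⟩
    0# + sum n (λ k → binomial (suc n) (suc (suc k)) * normalizedPower (suc k) n)
      ≈⟨ +-identityˡ _ ⟩
    sum n (λ k → binomial (suc n) (suc (suc k)) * normalizedPower (suc k) n)
      ≈⟨ sum-cong n (λ k → formulaTerm≈ n (suc k)) ⟨
    sum n (λ k → formulaTerm n (suc k)) ∎)

  BC≈formula : ∀ n → 1 ≤ n → BC n ≈ₖ formula N n
  BC≈formula n 1≤n = ≃⇒≈ₖ ≡.refl (val-formulaᶠ n) (begin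
    ⟨ BC n , BC≉0 n ⟩          ≈⟨ ι*÷ (BC n) (Π n) (BC≉0 n) (Π≉0 n) ⟨
    ι (Π n) * A n              ≈⟨ *-congˡ (⊛g≈-δ⇒geometricSum A A⊛g≈-δ n) ⟩
    ι (Π n) * geometricSum n n ≈⟨ geometricSum≈formula n 1≤n ⟩
    formulaᶠ n                 ∎)

open import Data.Nat using (_^_)
open import Data.Nat.Primality using (Prime; prime⇒nonTrivial; prime⇒nonZero)
open import Data.Product using (∃₂; _×_)

primePower>1 : ∀ {r} → (∃₂ λ p e → Prime p × r ≡ p ^ suc e) → 1 < r
primePower>1 (p , e , p-prime , ≡.refl) =
  ≤-trans (Data.Nat.nonTrivial⇒n>1 p {{prime⇒nonTrivial p-prime}}) (ℕ.m≤m*n p (p ^ e) {{ℕ.m^n≢0 p e {{prime⇒nonZero p-prime}}}})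

proposition1 : ∀ {c ℓ : Level} (r : ℕ) {{_ : NonZero r}} →
    (∃₂ λ p e → Prime p × r ≡ p ^ suc e) →
    (F : FiniteField r c ℓ) →
    (N : ℕ) → 1 ≤ N →
    (BC : ℕ → CarlitzBC.K F) → CarlitzBC.IsBC F N BC →
    (n : ℕ) → 1 ≤ n →
    CarlitzBC._≈ₖ_ F (BC n) (CarlitzBC.formula F N n)
proposition1 r r-primePower F N _ BC isBC n 1≤n = BernoulliCarlitz.BC≈formula F (primePower>1 r-primePower) N BC isBC n 1≤n
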